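{- Let $p$ be the mesh pattern $(12,R)$ with $R=\{(0,0),(0,1),(0,2),(1,1),(1,2),(2,0),(2,1)\}$, let $E(t,u)=\sum_{n\ge0}t^n\sum_{\sigma\in K_n}u^{p(\sigma)}$, and let $P(t)=\sum_{n\ge0}|K_n(p)|t^n$. Then $$P(t)=\left(1+\frac{t^2}{1+t}-\frac{t^2A(t)}{(1+t)^2}\right)A(t),\qquad E(t,u)=\left(1+\frac{t^2(1-u)}{1+t}-\frac{t^2(1-u)A(t)}{(1+t)^2}\right)A(t).$$ The initial terms of $E(t,u)$ are $1+t+2t^4+14t^5+(88+2u)t^6+(634+12u)t^7+(5164+78u)t^8+\cdots$.
   Context: A permutation $\sigma=\sigma_1\cdots\sigma_n$ of $\{1,\dots,n\}$ is a king permutation if $|\sigma_{i+1}-\sigma_i|>1$ for all $1\le i\le n-1$. $K_n$ is the set of king permutations of length $n$ ($K_0$ = the empty permutation, $K_1=\{1\}$) and $A(t)=\sum_{n\ge0}|K_n|t^n$ (known to equal $\sum_{n\ge0}n!\,t^n(1-t)^n/(1+t)^n$). For a mesh pattern $p=(12,R)$ with $R\subseteq\{0,1,2\}^2$, an occurrence of $p$ in $\sigma\in S_n$ is a pair of positions $i_1<i_2$ with $\sigma_{i_1}<\sigma_{i_2}$ such that for every $(x,y)\in R$ there is no position $m$ with $i_x<m<i_{x+1}$ and $v_y<\sigma_m<v_{y+1}$, where $i_0=0$, $i_3=n+1$, $v_0=0$, $v_1=\sigma_{i_1}$, $v_2=\sigma_{i_2}$, $v_3=n+1$ (first coordinate of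 a box indexes positions, second values). $p(\sigma)$ is the number of occurrences of $p$ in $\sigma$; $K_n(p)$ is the set of king $n$-permutations with $p(\sigma)=0$. -}

module Defs where

open import Data.Bool using (Bool; true; false; _∧_; _∨_; not; if_then_else_)
open import Data.Nat using (ℕ; zero; suc; _+_; _∸_; _≡ᵇ_; _<ᵇ_)
open import Data.List using (List; []; _∷_; map; concatMap; filterᵇ; length; upTo; foldr)
open import Data.Bool.ListAction using (all; any)
open import Data.Fin using (Fin; zero; suc)
open import Data.Vec using (Vec; []; _∷_; lookup)
open import Data.Product using (_×_; _,_)
open import Data.Integer as ℤ using (ℤ; +_; -_)

-- Permutations of {1,…,n}, as lists σ₁ … σₙ (one-line notation).

words : ℕ → ℕ → List (List ℕ)
words zero    n = [] ∷ []
words (suc k) n = concatMap (λ x → map (x ∷_) (words k n)) (map suc (upTo n))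

distinct : List ℕ → Bool
distinct []       = true
distinct (x ∷ xs) = not (any (λ y → x ≡ᵇ y) xs) ∧ distinct xs

S : ℕ → List (List ℕ)
S n = filterᵇ distinct (words n n)

-- σ at position i (positions 1-indexed); 0 outside 1..length
at : List ℕ → ℕ → ℕ
at []       _             = 0
at (x ∷ xs) zero          = 0
at (x ∷ xs) (suc zero)    = x
at (x ∷ xs) (suc (suc i)) = at xs (suc i)

between : ℕ → ℕ → List ℕ
between a b = map (λ k → suc (a + k)) (upTo (b ∸ suc a))

absDiffGt1 : ℕ → ℕ → Bool
absDiffGt1 a b = not (b ≡ᵇ suc a) ∧ not (a ≡ᵇ suc b) ∧ not (a ≡ᵇ b)

isKing : List ℕ → Bool
isKing σ = all (λ i → absDiffGt1 (at σ i) (at σ (suc i))) (between 0 (length σ))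

K : ℕ → List (List ℕ)
K n = filterᵇ isKing (S n)

Box : Set
Box = Fin 3 × Fin 3

occurrences : List Box → List ℕ → ℕ
occurrences R σ = length (filterᵇ isOcc pairs)
  where
  n = length σ
  pairs : List (ℕ × ℕ)
  pairs = concatMap (λ i₁ → map (λ i₂ → (i₁ , i₂)) (between i₁ (suc n)))
                    (between 0 (suc n))
  isOcc : ℕ × ℕ → Bool
  isOcc (i₁ , i₂) = (at σ i₁ <ᵇ at σ i₂) ∧ all boxEmpty R
    where
    pos : Vec ℕ 4
    pos = 0 ∷ i₁ ∷ i₂ ∷ suc n ∷ []
    val : Vec ℕ 4
    val = 0 ∷ at σ i₁ ∷ at σ i₂ ∷ suc n ∷ []
    low : Fin 3 → Fin 4
    low zero = zero
    low (suc zero) = suc zero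
    low (suc (suc zero)) = suc (suc zero)
    high : Fin 3 → Fin 4
    high zero = suc zero
    high (suc zero) = suc (suc zero)
    high (suc (suc zero)) = suc (suc (suc zero))
    boxEmpty : Box → Bool
    boxEmpty (x , y) =
      not (any (λ m → (lookup val (low y) <ᵇ at σ m) ∧ (at σ m <ᵇ lookup val (high y)))
               (between (lookup pos (low x)) (lookup pos (high x))))

Rp : List Box
Rp = (zero , zero) ∷ (zero , suc zero) ∷ (zero , suc (suc zero))
   ∷ (suc zero , suc zero) ∷ (suc zero , suc (suc zero))
   ∷ (suc (suc zero) , zero) ∷ (suc (suc zero) , suc zero) ∷ []

p : List ℕ → ℕ
p = occurrences Rp

Series : Set
Series = ℕ → ℤ

Series₂ : Set  -- f n k = coefficient of t^n u^k
Series₂ = ℕ → ℕ → ℤ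

sumℤ : List ℤ → ℤ
sumℤ = foldr ℤ._+_ (+ 0)

_⊛_ : Series → Series → Series
(f ⊛ g) n = sumℤ (map (λ i → f i ℤ.* g (n ∸ i)) (upTo (suc n)))

infixl 7 _⊛_
infixl 6 _⊕_ _⊖_
infixl 7 _⊛₂_
infixl 6 _⊕₂_ _⊖₂_

_⊕_ _⊖_ : Series → Series → Series
(f ⊕ g) n = f n ℤ.+ g n
(f ⊖ g) n = f n ℤ.- g n

one : Series
one zero = + 1
one (suc _) = + 0

t² : Series
t² 2 = + 1
t² _ = + 0

inv1+t : Series
inv1+t zero = + 1
inv1+t (suc n) = - inv1+t n

_⊛₂_ : Series₂ → Series₂ → Series₂
(f ⊛₂ g) n k = sumℤ (map (λ i → sumℤ (map (λ j → f i j ℤ.* g (n ∸ i) (k ∸ j))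
                                           (upTo (suc k))))
                          (upTo (suc n)))

_⊕₂_ _⊖₂_ : Series₂ → Series₂ → Series₂
(f ⊕₂ g) n k = f n k ℤ.+ g n k
(f ⊖₂ g) n k = f n k ℤ.- g n k

lift : Series → Series₂
lift f n zero    = f n
lift f n (suc _) = + 0

1-u : Series₂
1-u zero zero = + 1
1-u zero (suc zero) = - (+ 1)
1-u _ _ = + 0

A : Series
A n = + length (K n)

P : Series
P n = + length (filterᵇ (λ σ → p σ ≡ᵇ 0) (K n))

E : Series₂
E n k = + length (filterᵇ (λ σ → p σ ≡ᵇ k) (K n))

Prhs : Series
Prhs = (one ⊕ (t² ⊛ inv1+t) ⊖ (t² ⊛ (A ⊛ (inv1+t ⊛ inv1+t)))) ⊛ A

Erhs : Series₂
Erhs = (lift one ⊕₂ (lift (t² ⊛ inv1+t) ⊛₂ 1-u)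
                 ⊖₂ ((lift (t² ⊛ (A ⊛ (inv1+t ⊛ inv1+t)))) ⊛₂ 1-u)) ⊛₂ lift A

initE : Series₂
initE 0 0 = + 1
initE 1 0 = + 1
initE 4 0 = + 2
initE 5 0 = + 14
initE 6 0 = + 88
initE 6 1 = + 2
initE 7 0 = + 634
initE 7 1 = + 12
initE 8 0 = + 5164
initE 8 1 = + 78
initE _ _ = + 0

-- An occurrence of p in a permutation σ must consist of the first entry a = σ₁ and the entry a + 1, with all entries
-- in between smaller than a and all later entries larger than a + 1. So p(σ) ≤ 1, and the king permutations containing
-- p are exactly the direct sums α ⊞ π of a king permutation α of {1, …, a} starting with its maximum a ≥ 2 and a king
-- permutation π starting with 1. Deleting the first entry (and shifting) maps the king permutations of length m + 1
-- starting with m + 1, resp. with 1, bijectively onto those of length m not starting with m, resp. with 1. Splitting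
-- K_{m+1} by its first entry then shows that both counts D satisfy A_{m+1} = D_m + D_{m+1} and D₀ = 1, i.e.
-- D = A/(1 + t). Hence the king permutations containing p have generating function t²(D − 1)D and
-- E = A + (u − 1) t²(D − 1)D, from which both formulas follow by power series algebra; the initial terms are
-- computed from A₀, …, A₈.

module Submission where

open import Defs
open import Data.Bool using (Bool; true; false; T; not; _∧_; _∨_; if_then_else_)
open import Data.Bool.Properties using (T-∧; T?)
open import Data.Bool.ListAction using (and; any)
open import Data.Empty using (⊥; ⊥-elim)
open import Data.Unit using (tt)
open import Data.Nat as ℕ using (ℕ; zero; suc; pred; _∸_; _≤_; _<_; z≤n; s≤s; z<s; s<s; _≡ᵇ_; _<ᵇ_)
import Data.Nat.Properties as ℕP
import Data.Integer.Properties as ℤP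
open import Data.Integer.Solver using (module +-*-Solver)
open import Data.List using (List; []; _∷_; map; length; _++_; filterᵇ; concatMap; cartesianProduct; upTo; applyUpTo)
import Data.List.Properties as LP
open import Data.List.Membership.Propositional using (_∈_; find; lose)
import Data.List.Membership.Propositional.Properties as ∈P
open import Data.List.Membership.DecPropositional ℕP._≟_ using (_∈?_)
open import Data.List.Relation.Binary.Subset.Propositional using (_⊆_)
open import Data.List.Relation.Unary.Any using (here; there)
import Data.List.Relation.Unary.Any.Properties as AnyP
open import Data.List.Relation.Unary.All as All using (All; []; _∷_)
import Data.List.Relation.Unary.All.Properties as AllP
open import Data.List.Relation.Unary.AllPairs as AllPairs using ([]; _∷_)
import Data.List.Relation.Unary.AllPairs.Properties as AllPairsP
open import Data.List.Relation.Unary.Linked as Linked using (Linked; []; [-]; _∷_)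
import Data.List.Relation.Unary.Linked.Properties as LinkedP
open import Data.List.Relation.Unary.Unique.Propositional using (Unique)
import Data.List.Relation.Unary.Unique.Propositional.Properties as UniqueP
open import Data.Product using (_×_; _,_; proj₁; proj₂; ∃; ∃₂; uncurry)
open import Data.Sum using (_⊎_; inj₁; inj₂)
open import Function using (_∘_; id; const; Equivalence)
open import Relation.Binary using (tri<; tri≈; tri>)
open import Relation.Binary.PropositionalEquality
import Relation.Binary.Reasoning.Setoid as SetoidReasoning
open import Relation.Nullary using (¬_; yes; no)

module KingPermutations where

  open import Data.Nat using (_+_; _*_)

  unique-⊆⇒length-≤ : {A : Set} {xs ys : List A} → Unique xs → xs ⊆ ys → length xs ≤ length ys
  unique-⊆⇒length-≤ {xs = []}     _          _   = z≤n
  unique-⊆⇒length-≤ {xs = x ∷ xs} (x∉ ∷ !xs) x∷xs⊆ys with ∈P.∈-∃++ (x∷xs⊆ys (here refl))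
  ... | ys₁ , ys₂ , refl = ℕP.≤-trans (s≤s (unique-⊆⇒length-≤ !xs xs⊆ys₁++ys₂))
                                      (ℕP.≤-reflexive (sym (LP.length-++-sucʳ ys₁ x ys₂)))
    where
    xs⊆ys₁++ys₂ : xs ⊆ ys₁ ++ ys₂
    xs⊆ys₁++ys₂ {y} y∈xs with ∈P.∈-++⁻ ys₁ (x∷xs⊆ys (there y∈xs))
    ... | inj₁ y∈ys₁         = ∈P.∈-++⁺ˡ y∈ys₁
    ... | inj₂ (here refl)   = ⊥-elim (All.lookup x∉ y∈xs refl)
    ... | inj₂ (there y∈ys₂) = ∈P.∈-++⁺ʳ ys₁ y∈ys₂

  length-≡-⊆⊇ : {A : Set} {xs ys : List A} → Unique xs → Unique ys → xs ⊆ ys → ys ⊆ xs → length xs ≡ length ys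
  length-≡-⊆⊇ !xs !ys xs⊆ys ys⊆xs =
    ℕP.≤-antisym (unique-⊆⇒length-≤ !xs xs⊆ys) (unique-⊆⇒length-≤ !ys ys⊆xs)

  module _ {A : Set} where

    unique-all-equal⇒length-≤1 : {xs : List A} → Unique xs → (∀ {x y} → x ∈ xs → y ∈ xs → x ≡ y) →
                                 length xs ≤ 1
    unique-all-equal⇒length-≤1 {[]}     _ _ = z≤n
    unique-all-equal⇒length-≤1 {x ∷ xs} !xs all-equal =
      unique-⊆⇒length-≤ {ys = x ∷ []} !xs (λ y∈ → here (all-equal y∈ (here refl)))

    length-filterᵇ-not : ∀ (q : A → Bool) xs → length (filterᵇ q xs) ℕ.+ length (filterᵇ (not ∘ q) xs) ≡ length xs
    length-filterᵇ-not q []       = refl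
    length-filterᵇ-not q (x ∷ xs) with q x
    ... | true  = cong suc (length-filterᵇ-not q xs)
    ... | false = trans (ℕP.+-suc _ _) (cong suc (length-filterᵇ-not q xs))

    filterᵇ-cong-∈ : ∀ {q r : A → Bool} xs → (∀ {x} → x ∈ xs → q x ≡ r x) → filterᵇ q xs ≡ filterᵇ r xs
    filterᵇ-cong-∈ []       _   = refl
    filterᵇ-cong-∈ {q} {r} (x ∷ xs) q≡r with q x | r x | q≡r (here refl)
    ... | true  | true  | _ = cong (x ∷_) (filterᵇ-cong-∈ xs (q≡r ∘ there))
    ... | false | false | _ = filterᵇ-cong-∈ xs (q≡r ∘ there)

    unique-++⁻ˡ : ∀ (xs : List A) {ys} → Unique (xs ++ ys) → Unique xs
    unique-++⁻ˡ []       _          = []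
    unique-++⁻ˡ (x ∷ xs) (x∉ ∷ !xs) = AllP.++⁻ˡ xs x∉ ∷ unique-++⁻ˡ xs !xs

    unique-++⁻ʳ : ∀ (xs : List A) {ys} → Unique (xs ++ ys) → Unique ys
    unique-++⁻ʳ []       !ys       = !ys
    unique-++⁻ʳ (x ∷ xs) (_ ∷ !xs) = unique-++⁻ʳ xs !xs

    ++-injective-length : ∀ (xs xs′ : List A) {ys ys′} → length xs ≡ length xs′ → xs ++ ys ≡ xs′ ++ ys′ →
                          xs ≡ xs′ × ys ≡ ys′
    ++-injective-length []       []         _       eq = refl , eq
    ++-injective-length (x ∷ xs) (x′ ∷ xs′) |xs|≡|xs′| eq with LP.∷-injective eq
    ... | refl , eq′ with ++-injective-length xs xs′ (ℕP.suc-injective |xs|≡|xs′|) eq′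
    ... | refl , ys≡ys′ = refl , ys≡ys′

    filterᵇ-∧ : ∀ (q r : A → Bool) xs → filterᵇ (λ x → q x ∧ r x) xs ≡ filterᵇ r (filterᵇ q xs)
    filterᵇ-∧ q r []       = refl
    filterᵇ-∧ q r (x ∷ xs) with q x
    ... | false = filterᵇ-∧ q r xs
    ... | true with r x
    ...   | true  = cong (x ∷_) (filterᵇ-∧ q r xs)
    ...   | false = filterᵇ-∧ q r xs

  module _ {A B : Set} (f : A → B) where

    unique-map⁺ : {xs : List A} → (∀ {x y} → x ∈ xs → y ∈ xs → f x ≡ f y → x ≡ y) →
                  Unique xs → Unique (map f xs)
    unique-map⁺ {[]}     _   _          = []
    unique-map⁺ {x ∷ xs} inj (x∉ ∷ !xs) =
      All.tabulate fx∉ ∷ unique-map⁺ (λ x∈ y∈ → inj (there x∈) (there y∈)) !xs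
      where
      fx∉ : ∀ {z} → z ∈ map f xs → f x ≢ z
      fx∉ z∈ fx≡z with ∈P.∈-map⁻ f z∈
      ... | y , y∈ , refl = All.lookup x∉ y∈ (inj (here refl) (there y∈) fx≡z)

    length-≡-bijection : {xs : List A} {ys : List B} → Unique xs → Unique ys →
                         (∀ {x} → x ∈ xs → f x ∈ ys) →
                         (∀ {x y} → x ∈ xs → y ∈ xs → f x ≡ f y → x ≡ y) →
                         (∀ {y} → y ∈ ys → ∃ λ x → x ∈ xs × f x ≡ y) →
                         length xs ≡ length ys
    length-≡-bijection {xs} {ys} !xs !ys into inj onto =
      trans (sym (LP.length-map f xs)) (length-≡-⊆⊇ (unique-map⁺ inj !xs) !ys image⊆ys ys⊆image)
      where
      image⊆ys : map f xs ⊆ ys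
      image⊆ys y∈ with ∈P.∈-map⁻ f y∈
      ... | x , x∈ , refl = into x∈
      ys⊆image : ys ⊆ map f xs
      ys⊆image y∈ with onto y∈
      ... | x , x∈ , refl = ∈P.∈-map⁺ f x∈

  module _ {A B : Set} where

    filterᵇ-map : ∀ (q : B → Bool) (f : A → B) xs → filterᵇ q (map f xs) ≡ map f (filterᵇ (q ∘ f) xs)
    filterᵇ-map q f []       = refl
    filterᵇ-map q f (x ∷ xs) with q (f x)
    ... | true  = cong (f x ∷_) (filterᵇ-map q f xs)
    ... | false = filterᵇ-map q f xs

    length-cartesianProduct : ∀ (xs : List A) (ys : List B) → length (cartesianProduct xs ys) ≡ length xs ℕ.* length ys
    length-cartesianProduct []       ys = refl
    length-cartesianProduct (x ∷ xs) ys =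
      trans (LP.length-++ (map (x ,_) ys)) (cong₂ ℕ._+_ (LP.length-map (x ,_) ys) (length-cartesianProduct xs ys))

  module _ {A B C : Set} (c : A → B → C) (F : A → List B) where

    ∈-concatMap-map⁻ : ∀ xs {z} → z ∈ concatMap (λ x → map (c x) (F x)) xs →
                       ∃₂ λ x y → x ∈ xs × y ∈ F x × z ≡ c x y
    ∈-concatMap-map⁻ xs z∈ with find (∈P.∈-concatMap⁻ (λ x → map (c x) (F x)) {xs = xs} z∈)
    ... | x , x∈ , z∈F with ∈P.∈-map⁻ (c x) z∈F
    ... | y , y∈ , refl = x , y , x∈ , y∈ , refl

    ∈-concatMap-map⁺ : ∀ xs {x y} → x ∈ xs → y ∈ F x → c x y ∈ concatMap (λ x → map (c x) (F x)) xs
    ∈-concatMap-map⁺ xs x∈ y∈ = ∈P.∈-concatMap⁺ (λ x → map (c x) (F x)) (lose x∈ (∈P.∈-map⁺ (c _) y∈))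

    unique-concatMap-map : (∀ {x x′ y y′} → c x y ≡ c x′ y′ → x ≡ x′ × y ≡ y′) →
                           ∀ {xs} → Unique xs → (∀ x → Unique (F x)) → Unique (concatMap (λ x → map (c x) (F x)) xs)
    unique-concatMap-map c-injective !xs !F =
      UniqueP.concat⁺ (AllP.map⁺ (All.universal (λ x → UniqueP.map⁺ (proj₂ ∘ c-injective) (!F x)) _))
                      (AllPairsP.map⁺ (AllPairs.map disjoint !xs))
      where
      disjoint : ∀ {x x′} → x ≢ x′ → ∀ {z} → z ∈ map (c x) (F x) × z ∈ map (c x′) (F x′) → ⊥
      disjoint x≢x′ (z∈ , z∈′) with ∈P.∈-map⁻ (c _) z∈ | ∈P.∈-map⁻ (c _) z∈′
      ... | _ , _ , refl | _ , _ , eq = x≢x′ (proj₁ (c-injective eq))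

  T-not⇒¬T : ∀ {b} → T (not b) → ¬ T b
  T-not⇒¬T {false} _ ()

  ¬T⇒T-not : ∀ {b} → ¬ T b → T (not b)
  ¬T⇒T-not {false} _   = tt
  ¬T⇒T-not {true}  ¬tt = ¬tt tt

  T-not-≡ᵇ⇒≢ : ∀ {m n} → T (not (m ≡ᵇ n)) → m ≢ n
  T-not-≡ᵇ⇒≢ {m} {n} t m≡n = T-not⇒¬T t (ℕP.≡⇒≡ᵇ m n m≡n)

  ≢⇒T-not-≡ᵇ : ∀ {m n} → m ≢ n → T (not (m ≡ᵇ n))
  ≢⇒T-not-≡ᵇ {m} {n} m≢n = ¬T⇒T-not (m≢n ∘ ℕP.≡ᵇ⇒≡ m n)

  T-∧⁻ : ∀ {a b} → T (a ∧ b) → T a × T b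
  T-∧⁻ = Equivalence.to T-∧

  T-∧⁺ : ∀ {a b} → T a → T b → T (a ∧ b)
  T-∧⁺ ta tb = Equivalence.from T-∧ (ta , tb)

  InRange : ℕ → ℕ → Set
  InRange n x = 1 ≤ x × x ≤ n

  oneTo : ℕ → List ℕ
  oneTo n = map suc (upTo n)

  ∈-oneTo⁻ : ∀ {n x} → x ∈ oneTo n → InRange n x
  ∈-oneTo⁻ x∈ with ∈P.∈-map⁻ suc x∈
  ... | i , i∈ , refl = s≤s z≤n , ∈P.∈-upTo⁻ i∈

  ∈-oneTo⁺ : ∀ {n x} → InRange n x → x ∈ oneTo n
  ∈-oneTo⁺ {x = suc x} (_ , x<n) = ∈P.∈-map⁺ suc (∈P.∈-upTo⁺ x<n)

  oneTo-unique : ∀ n → Unique (oneTo n)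
  oneTo-unique n = UniqueP.map⁺ ℕP.suc-injective (UniqueP.upTo⁺ n)

  length-oneTo : ∀ n → length (oneTo n) ≡ n
  length-oneTo n = trans (LP.length-map suc (upTo n)) (LP.length-upTo n)

  record IsPerm (n : ℕ) (σ : List ℕ) : Set where
    constructor isPerm
    field
      length≡ : length σ ≡ n
      inRange : All (InRange n) σ
      unique  : Unique σ

  ∈-words⁻ : ∀ k n {w} → w ∈ words k n → length w ≡ k × All (InRange n) w
  ∈-words⁻ zero    n (here refl) = refl , []
  ∈-words⁻ (suc k) n w∈ with ∈-concatMap-map⁻ _∷_ (λ _ → words k n) (oneTo n) w∈
  ... | x , w′ , x∈ , w′∈ , refl with ∈-words⁻ k n w′∈
  ... | |w′|≡k , w′-inRange = cong suc |w′|≡k , ∈-oneTo⁻ x∈ ∷ w′-inRange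

  ∈-words⁺ : ∀ k n {w} → length w ≡ k → All (InRange n) w → w ∈ words k n
  ∈-words⁺ zero    n {[]}    _     _                 = here refl
  ∈-words⁺ (suc k) n {x ∷ w} |w|≡k (x-inRange ∷ w-inRange) =
    ∈-concatMap-map⁺ _∷_ (λ _ → words k n) (oneTo n) (∈-oneTo⁺ x-inRange)
                     (∈-words⁺ k n (ℕP.suc-injective |w|≡k) w-inRange)

  words-unique : ∀ k n → Unique (words k n)
  words-unique zero    n = [] ∷ []
  words-unique (suc k) n =
    unique-concatMap-map _∷_ (λ _ → words k n) LP.∷-injective (oneTo-unique n) (λ _ → words-unique k n)

  notAny≡ᵇ⇒All≢ : ∀ x xs → T (not (any (x ≡ᵇ_) xs)) → All (x ≢_) xs
  notAny≡ᵇ⇒All≢ x xs t =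
    All.tabulate (λ {y} y∈ x≡y → T-not⇒¬T t (AnyP.any⁺ (x ≡ᵇ_) (lose y∈ (ℕP.≡⇒≡ᵇ x y x≡y))))

  All≢⇒notAny≡ᵇ : ∀ x xs → All (x ≢_) xs → T (not (any (x ≡ᵇ_) xs))
  All≢⇒notAny≡ᵇ x xs x∉ = ¬T⇒T-not λ t → let y , y∈ , x≡ᵇy = find (AnyP.any⁻ (x ≡ᵇ_) xs t) in
                                         All.lookup x∉ y∈ (ℕP.≡ᵇ⇒≡ x y x≡ᵇy)

  distinct⇒Unique : ∀ w → T (distinct w) → Unique w
  distinct⇒Unique []      _ = []
  distinct⇒Unique (x ∷ w) t with T-∧⁻ t
  ... | x∉w , distinct-w = notAny≡ᵇ⇒All≢ x w x∉w ∷ distinct⇒Unique w distinct-w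

  Unique⇒distinct : ∀ w → Unique w → T (distinct w)
  Unique⇒distinct []      _           = tt
  Unique⇒distinct (x ∷ w) (x∉w ∷ !w) = T-∧⁺ (All≢⇒notAny≡ᵇ x w x∉w) (Unique⇒distinct w !w)

  S-unique : ∀ n → Unique (S n)
  S-unique n = UniqueP.filter⁺ (T? ∘ distinct) (words-unique n n)

  ∈S⁻ : ∀ n {σ} → σ ∈ S n → IsPerm n σ
  ∈S⁻ n {σ} σ∈ with ∈P.∈-filter⁻ (T? ∘ distinct) σ∈
  ... | σ∈words , distinct-σ with ∈-words⁻ n n σ∈words
  ... | |σ|≡n , σ-inRange = isPerm |σ|≡n σ-inRange (distinct⇒Unique σ distinct-σ)

  ∈S⁺ : ∀ n {σ} → IsPerm n σ → σ ∈ S n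
  ∈S⁺ n {σ} (isPerm |σ|≡n σ-inRange !σ) =
    ∈P.∈-filter⁺ (T? ∘ distinct) (∈-words⁺ n n |σ|≡n σ-inRange) (Unique⇒distinct σ !σ)

  Apart : ℕ → ℕ → Set
  Apart a b = b ≢ suc a × a ≢ suc b × a ≢ b

  King : List ℕ → Set
  King = Linked Apart

  absDiffGt1⇒Apart : ∀ a b → T (absDiffGt1 a b) → Apart a b
  absDiffGt1⇒Apart a b t with T-∧⁻ t
  ... | b≢1+a , t′ with T-∧⁻ t′
  ... | a≢1+b , a≢b = T-not-≡ᵇ⇒≢ b≢1+a , T-not-≡ᵇ⇒≢ a≢1+b , T-not-≡ᵇ⇒≢ a≢b

  Apart⇒absDiffGt1 : ∀ a b → Apart a b → T (absDiffGt1 a b)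
  Apart⇒absDiffGt1 a b (b≢1+a , a≢1+b , a≢b) =
    T-∧⁺ (≢⇒T-not-≡ᵇ b≢1+a) (T-∧⁺ (≢⇒T-not-≡ᵇ a≢1+b) (≢⇒T-not-≡ᵇ a≢b))

  isKing-applyUpTo : ∀ σ →
    isKing σ ≡ and (applyUpTo (λ i → absDiffGt1 (at σ (suc i)) (at σ (suc (suc i)))) (length σ ∸ 1))
  isKing-applyUpTo σ = cong and (trans (cong (map adjacentApart) (LP.map-upTo suc (length σ ∸ 1)))
                                       (LP.map-applyUpTo suc adjacentApart (length σ ∸ 1)))
    where
    adjacentApart : ℕ → Bool
    adjacentApart i = absDiffGt1 (at σ i) (at σ (suc i))

  isKing-∷-∷ : ∀ x y w → isKing (x ∷ y ∷ w) ≡ absDiffGt1 x y ∧ isKing (y ∷ w)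
  isKing-∷-∷ x y w = trans (isKing-applyUpTo (x ∷ y ∷ w)) (cong (absDiffGt1 x y ∧_) (sym (isKing-applyUpTo (y ∷ w))))

  isKing⇒King : ∀ σ → T (isKing σ) → King σ
  isKing⇒King []          _ = []
  isKing⇒King (x ∷ [])    _ = [-]
  isKing⇒King (x ∷ y ∷ w) t =
    absDiffGt1⇒Apart x y (proj₁ t′) ∷ isKing⇒King (y ∷ w) (proj₂ t′)
    where
    t′ : T (absDiffGt1 x y) × T (isKing (y ∷ w))
    t′ = T-∧⁻ (subst T (isKing-∷-∷ x y w) t)

  King⇒isKing : ∀ σ → King σ → T (isKing σ)
  King⇒isKing []          _                = tt
  King⇒isKing (x ∷ [])    _                = tt
  King⇒isKing (x ∷ y ∷ w) (x-apart-y ∷ kw) =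
    subst T (sym (isKing-∷-∷ x y w)) (T-∧⁺ (Apart⇒absDiffGt1 x y x-apart-y) (King⇒isKing (y ∷ w) kw))

  K-unique : ∀ n → Unique (K n)
  K-unique n = UniqueP.filter⁺ (T? ∘ isKing) (S-unique n)

  ∈K⁻ : ∀ n {σ} → σ ∈ K n → IsPerm n σ × King σ
  ∈K⁻ n {σ} σ∈ with ∈P.∈-filter⁻ (T? ∘ isKing) σ∈
  ... | σ∈S , king-σ = ∈S⁻ n σ∈S , isKing⇒King σ king-σ

  ∈K⁺ : ∀ n {σ} → IsPerm n σ → King σ → σ ∈ K n
  ∈K⁺ n {σ} perm king = ∈P.∈-filter⁺ (T? ∘ isKing) (∈S⁺ n perm) (King⇒isKing σ king)

  <⇒Apart : ∀ {x y} → suc x < y → Apart x y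
  <⇒Apart {x} {y} 1+x<y = ℕP.>⇒≢ 1+x<y , ℕP.<⇒≢ (ℕP.<-trans x<y (ℕP.n<1+n y)) , ℕP.<⇒≢ x<y
    where
    x<y : x < y
    x<y = ℕP.<-trans (ℕP.n<1+n x) 1+x<y

  Apart-sym : ∀ {x y} → Apart x y → Apart y x
  Apart-sym (y≢1+x , x≢1+y , x≢y) = x≢1+y , y≢1+x , x≢y ∘ sym

  Apart-+ : ∀ c {x y} → Apart x y → Apart (c + x) (c + y)
  Apart-+ c (y≢1+x , x≢1+y , x≢y) =
    y≢1+x ∘ ℕP.+-cancelˡ-≡ c _ _ ∘ (λ e → trans e (sym (ℕP.+-suc c _))) ,
    x≢1+y ∘ ℕP.+-cancelˡ-≡ c _ _ ∘ (λ e → trans e (sym (ℕP.+-suc c _))) ,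
    x≢y ∘ ℕP.+-cancelˡ-≡ c _ _

  Apart-+⁻ : ∀ c {x y} → Apart (c + x) (c + y) → Apart x y
  Apart-+⁻ c {x} {y} (p , q , r) =
    (λ y≡1+x → p (trans (cong (c +_) y≡1+x) (ℕP.+-suc c x))) ,
    (λ x≡1+y → q (trans (cong (c +_) x≡1+y) (ℕP.+-suc c y))) ,
    r ∘ cong (c +_)

  king-++ : ∀ {xs y ys} → King xs → All (λ x → Apart x y) xs → King (y ∷ ys) → King (xs ++ y ∷ ys)
  king-++ []           []              king-y∷ys = king-y∷ys
  king-++ [-]          (x-apart-y ∷ []) king-y∷ys = x-apart-y ∷ king-y∷ys
  king-++ (apart ∷ kxs) (_ ∷ apart-y)   king-y∷ys = apart ∷ king-++ kxs apart-y king-y∷ys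

  king-++⁻ˡ : ∀ xs {ys} → King (xs ++ ys) → King xs
  king-++⁻ˡ []           _            = []
  king-++⁻ˡ (x ∷ [])     _            = [-]
  king-++⁻ˡ (x ∷ y ∷ xs) (apart ∷ k) = apart ∷ king-++⁻ˡ (y ∷ xs) k

  king-++⁻ʳ : ∀ xs {ys} → King (xs ++ ys) → King ys
  king-++⁻ʳ []       k = k
  king-++⁻ʳ (x ∷ xs) k = king-++⁻ʳ xs (Linked.tail k)

  shift-unshift : ∀ c {β} → All (c <_) β → map (c +_) (map (_∸ c) β) ≡ β
  shift-unshift c {β} c<β = trans (sym (LP.map-∘ β)) (LP.map-id-local (All.map (ℕP.m+[n∸m]≡n ∘ ℕP.<⇒≤) c<β))

  king-shift : ∀ c {π} → King π → King (map (c +_) π)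
  king-shift c k = LinkedP.map⁺ (Linked.map (Apart-+ c) k)

  king-unshift : ∀ c {β} → All (c <_) β → King β → King (map (_∸ c) β)
  king-unshift c c<β kβ = Linked.map (Apart-+⁻ c) (LinkedP.map⁻ (subst King (sym (shift-unshift c c<β)) kβ))

  -- Occurrences of the pattern

  at-∈ : ∀ σ k → k < length σ → at σ (suc k) ∈ σ
  at-∈ (x ∷ σ) zero    _        = here refl
  at-∈ (x ∷ σ) (suc k) (s≤s k<) = there (at-∈ σ k k<)

  ∈⇒at : ∀ {σ x} → x ∈ σ → ∃ λ k → k < length σ × at σ (suc k) ≡ x
  ∈⇒at (here refl) = 0 , z<s , refl
  ∈⇒at {y ∷ σ} (there x∈) with ∈⇒at x∈
  ... | k , k< , atₖ≡x = suc k , s<s k< , atₖ≡x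

  at-injective : ∀ {σ} → Unique σ → ∀ {k k′} → k < length σ → k′ < length σ →
                 at σ (suc k) ≡ at σ (suc k′) → k ≡ k′
  at-injective {x ∷ σ} _        {zero}  {zero}   _        _         _ = refl
  at-injective {x ∷ σ} (x∉ ∷ _) {zero}  {suc k′} _        (s≤s k′<) e = ⊥-elim (All.lookup x∉ (at-∈ σ k′ k′<) e)
  at-injective {x ∷ σ} (x∉ ∷ _) {suc k} {zero}   (s≤s k<) _         e = ⊥-elim (All.lookup x∉ (at-∈ σ k k<) (sym e))
  at-injective {x ∷ σ} (_ ∷ !σ) {suc k} {suc k′} (s≤s k<) (s≤s k′<) e = cong suc (at-injective !σ k< k′< e)

  at-inRange : ∀ {n σ} → IsPerm n σ → ∀ k → k < length σ → InRange n (at σ (suc k))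
  at-inRange {σ = σ} perm k k< = All.lookup (IsPerm.inRange perm) (at-∈ σ k k<)

  at-++ˡ : ∀ xs ys k → k < length xs → at (xs ++ ys) (suc k) ≡ at xs (suc k)
  at-++ˡ (x ∷ xs) ys zero    _        = refl
  at-++ˡ (x ∷ xs) ys (suc k) (s≤s k<) = at-++ˡ xs ys k k<

  ∈-between⁻ : ∀ {lo hi m} → m ∈ between lo hi → lo < m × m < hi
  ∈-between⁻ {lo} {hi} m∈ with ∈P.∈-map⁻ (λ k → suc (lo + k)) m∈
  ... | k , k∈ , refl =
    s≤s (ℕP.m≤m+n lo k) , subst (_≤ hi) (cong suc (ℕP.+-comm k (suc lo))) (ℕP.m≤o∸n⇒m+n≤o (suc k) 1+lo≤hi k<)
    where
    k< : k < hi ∸ suc lo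
    k< = ∈P.∈-upTo⁻ k∈
    1+lo≤hi : suc lo ≤ hi
    1+lo≤hi = ℕP.<⇒≤ (ℕP.m∸n≢0⇒n<m {hi} {suc lo} (λ hi∸1+lo≡0 → ℕP.n≮0 (subst (k <_) hi∸1+lo≡0 k<)))

  ∈-between⁺ : ∀ {lo hi m} → lo < m → m < hi → m ∈ between lo hi
  ∈-between⁺ {lo} {hi} {m} lo<m m<hi =
    subst (_∈ between lo hi) (ℕP.m+[n∸m]≡n lo<m)
          (∈P.∈-map⁺ (λ k → suc (lo + k)) (∈P.∈-upTo⁺ (ℕP.∸-monoˡ-< m<hi lo<m)))

  between-unique : ∀ lo hi → Unique (between lo hi)
  between-unique lo hi = UniqueP.map⁺ (ℕP.+-cancelˡ-≡ lo _ _ ∘ ℕP.suc-injective) (UniqueP.upTo⁺ _)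

  NoPointIn : List ℕ → (lo hi vlo vhi : ℕ) → Set
  NoPointIn σ lo hi vlo vhi = ∀ m → lo < m → m < hi → ¬ (vlo < at σ m × at σ m < vhi)

  record Occurrence (σ : List ℕ) (i j : ℕ) : Set where
    field
      1≤i   : 1 ≤ i
      i<j   : i < j
      j≤n   : j ≤ length σ
      σᵢ<σⱼ : at σ i < at σ j
      box₀₀ : NoPointIn σ 0 i 0 (at σ i)
      box₀₁ : NoPointIn σ 0 i (at σ i) (at σ j)
      box₀₂ : NoPointIn σ 0 i (at σ j) (suc (length σ))
      box₁₁ : NoPointIn σ i j (at σ i) (at σ j)
      box₁₂ : NoPointIn σ i j (at σ j) (suc (length σ))
      box₂₀ : NoPointIn σ j (suc (length σ)) 0 (at σ i)
      box₂₁ : NoPointIn σ j (suc (length σ)) (at σ i) (at σ j)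

  noPointInᵇ : List ℕ → (lo hi vlo vhi : ℕ) → Bool
  noPointInᵇ σ lo hi vlo vhi = not (any (λ m → (vlo <ᵇ at σ m) ∧ (at σ m <ᵇ vhi)) (between lo hi))

  -- Definitionally the pair list and the test in `occurrences Rp`, with the seven boxes unfolded.
  occurrencePairs : List ℕ → List (ℕ × ℕ)
  occurrencePairs σ = concatMap (λ i → map (i ,_) (between i (suc (length σ)))) (between 0 (suc (length σ)))

  isOccurrence : List ℕ → ℕ × ℕ → Bool
  isOccurrence σ (i , j) =
    (a <ᵇ b) ∧ (noPointInᵇ σ 0 i 0 a ∧ (noPointInᵇ σ 0 i a b ∧ (noPointInᵇ σ 0 i b N ∧
    (noPointInᵇ σ i j a b ∧ (noPointInᵇ σ i j b N ∧ (noPointInᵇ σ j N 0 a ∧ (noPointInᵇ σ j N a b ∧ true)))))))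
    where
    a b N : ℕ
    a = at σ i
    b = at σ j
    N = suc (length σ)

  noPointInᵇ⇒NoPointIn : ∀ σ lo hi vlo vhi → T (noPointInᵇ σ lo hi vlo vhi) → NoPointIn σ lo hi vlo vhi
  noPointInᵇ⇒NoPointIn σ lo hi vlo vhi t m lo<m m<hi (vlo<σₘ , σₘ<vhi) =
    T-not⇒¬T t (AnyP.any⁺ _ (lose (∈-between⁺ lo<m m<hi) (T-∧⁺ (ℕP.<⇒<ᵇ vlo<σₘ) (ℕP.<⇒<ᵇ σₘ<vhi))))

  NoPointIn⇒noPointInᵇ : ∀ σ lo hi vlo vhi → NoPointIn σ lo hi vlo vhi → T (noPointInᵇ σ lo hi vlo vhi)
  NoPointIn⇒noPointInᵇ σ lo hi vlo vhi empty = ¬T⇒T-not λ t →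
    let m , m∈ , inBox = find (AnyP.any⁻ _ (between lo hi) t)
        lo<m , m<hi = ∈-between⁻ m∈
        vlo<ᵇσₘ , σₘ<ᵇvhi = T-∧⁻ inBox
    in empty m lo<m m<hi (ℕP.<ᵇ⇒< vlo (at σ m) vlo<ᵇσₘ , ℕP.<ᵇ⇒< (at σ m) vhi σₘ<ᵇvhi)

  occurrencePairs-unique : ∀ σ → Unique (occurrencePairs σ)
  occurrencePairs-unique σ = unique-concatMap-map _,_ (λ i → between i (suc (length σ)))
    (λ { refl → refl , refl }) (between-unique 0 (suc (length σ))) (λ i → between-unique i (suc (length σ)))

  ∈-occurrences⁻ : ∀ σ {i j} → (i , j) ∈ filterᵇ (isOccurrence σ) (occurrencePairs σ) → Occurrence σ i j
  ∈-occurrences⁻ σ {i} {j} ij∈ with ∈P.∈-filter⁻ (T? ∘ isOccurrence σ) ij∈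
  ... | ij∈pairs , t with ∈-concatMap-map⁻ _,_ (λ i → between i (suc (length σ))) (between 0 (suc (length σ))) ij∈pairs
  ... | .i , .j , i∈ , j∈ , refl =
    let σᵢ<σⱼ , t₀₀ = T-∧⁻ t
        b₀₀ , t₀₁ = T-∧⁻ t₀₀
        b₀₁ , t₀₂ = T-∧⁻ t₀₁
        b₀₂ , t₁₁ = T-∧⁻ t₀₂
        b₁₁ , t₁₂ = T-∧⁻ t₁₁
        b₁₂ , t₂₀ = T-∧⁻ t₁₂
        b₂₀ , t₂₁ = T-∧⁻ t₂₀
        b₂₁ , _   = T-∧⁻ t₂₁
    in record
      { 1≤i   = proj₁ (∈-between⁻ {0} {suc (length σ)} i∈)
      ; i<j   = proj₁ (∈-between⁻ {i} {suc (length σ)} j∈)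
      ; j≤n   = ℕP.≤-pred (proj₂ (∈-between⁻ {i} {suc (length σ)} j∈))
      ; σᵢ<σⱼ = ℕP.<ᵇ⇒< _ _ σᵢ<σⱼ
      ; box₀₀ = noPointInᵇ⇒NoPointIn σ _ _ _ _ b₀₀
      ; box₀₁ = noPointInᵇ⇒NoPointIn σ _ _ _ _ b₀₁
      ; box₀₂ = noPointInᵇ⇒NoPointIn σ _ _ _ _ b₀₂
      ; box₁₁ = noPointInᵇ⇒NoPointIn σ _ _ _ _ b₁₁
      ; box₁₂ = noPointInᵇ⇒NoPointIn σ _ _ _ _ b₁₂
      ; box₂₀ = noPointInᵇ⇒NoPointIn σ _ _ _ _ b₂₀
      ; box₂₁ = noPointInᵇ⇒NoPointIn σ _ _ _ _ b₂₁
      }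

  ∈-occurrences⁺ : ∀ σ {i j} → Occurrence σ i j → (i , j) ∈ filterᵇ (isOccurrence σ) (occurrencePairs σ)
  ∈-occurrences⁺ σ {i} {j} o = ∈P.∈-filter⁺ (T? ∘ isOccurrence σ)
    (∈-concatMap-map⁺ _,_ (λ i → between i (suc (length σ))) (between 0 (suc (length σ)))
       (∈-between⁺ 1≤i (ℕP.<-trans i<j (s≤s j≤n))) (∈-between⁺ i<j (s≤s j≤n)))
    (T-∧⁺ (ℕP.<⇒<ᵇ σᵢ<σⱼ) (T-∧⁺ (encode box₀₀) (T-∧⁺ (encode box₀₁) (T-∧⁺ (encode box₀₂)
      (T-∧⁺ (encode box₁₁) (T-∧⁺ (encode box₁₂) (T-∧⁺ (encode box₂₀) (T-∧⁺ (encode box₂₁) tt))))))))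
    where
    open Occurrence o
    encode : ∀ {lo hi vlo vhi} → NoPointIn σ lo hi vlo vhi → T (noPointInᵇ σ lo hi vlo vhi)
    encode = NoPointIn⇒noPointInᵇ σ _ _ _ _

  Band : ℕ → ℕ → ℕ → Set
  Band z a b = z < a ⊎ (a < z × z < b) ⊎ b < z

  trichotomy-≢ : ∀ {z a b} → z ≢ a → z ≢ b → a < b → Band z a b
  trichotomy-≢ {z} {a} {b} z≢a z≢b a<b with ℕP.<-cmp z a | ℕP.<-cmp z b
  ... | tri< z<a _ _ | _            = inj₁ z<a
  ... | tri≈ _ z≡a _ | _            = ⊥-elim (z≢a z≡a)
  ... | tri> _ _ a<z | tri< z<b _ _ = inj₂ (inj₁ (a<z , z<b))
  ... | tri> _ _ _   | tri≈ _ z≡b _ = ⊥-elim (z≢b z≡b)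
  ... | tri> _ _ _   | tri> _ _ b<z = inj₂ (inj₂ b<z)

  module _ {n σ} (perm : IsPerm n σ) where

    private
      value-bounds : ∀ {m} → 1 ≤ m → m ≤ length σ → 0 < at σ m × at σ m < suc (length σ)
      value-bounds {suc k} _ k< with at-inRange perm k k<
      ... | 1≤v , v≤n = 1≤v , s≤s (subst (_ ≤_) (sym (IsPerm.length≡ perm)) v≤n)

      at-≢ : ∀ {m m′} → 1 ≤ m → m ≤ length σ → 1 ≤ m′ → m′ ≤ length σ → m ≢ m′ →
             at σ m ≢ at σ m′
      at-≢ {suc k} {suc k′} _ k< _ k′< m≢m′ = m≢m′ ∘ cong suc ∘ at-injective (IsPerm.unique perm) k< k′<

    module _ {i j} (o : Occurrence σ i j) where
      open Occurrence o

      private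
        j≥1 : 1 ≤ j
        j≥1 = ℕP.≤-trans 1≤i (ℕP.<⇒≤ i<j)

        i≤n : i ≤ length σ
        i≤n = ℕP.≤-trans (ℕP.<⇒≤ i<j) j≤n

        classify : ∀ {m} → 1 ≤ m → m ≤ length σ → m ≢ i → m ≢ j → Band (at σ m) (at σ i) (at σ j)
        classify 1≤m m≤n m≢i m≢j =
          trichotomy-≢ (at-≢ 1≤m m≤n 1≤i i≤n m≢i) (at-≢ 1≤m m≤n j≥1 j≤n m≢j) σᵢ<σⱼ

      occurrence-starts-at-1 : i ≡ 1
      occurrence-starts-at-1 = ℕP.≤-antisym (ℕP.≮⇒≥ (λ 1<i → before 1<i (classify₁ 1<i))) 1≤i
        where
        1≤n : 1 ≤ length σ
        1≤n = ℕP.≤-trans j≥1 j≤n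
        classify₁ : 1 < i → Band (at σ 1) (at σ i) (at σ j)
        classify₁ 1<i = classify (s≤s z≤n) 1≤n (ℕP.<⇒≢ 1<i) (ℕP.<⇒≢ (ℕP.<-trans 1<i i<j))
        before : 1 < i → Band (at σ 1) (at σ i) (at σ j) → ⊥
        before 1<i (inj₁ σ₁<σᵢ)          = box₀₀ 1 z<s 1<i (proj₁ (value-bounds (s≤s z≤n) 1≤n) , σ₁<σᵢ)
        before 1<i (inj₂ (inj₁ σᵢ<σ₁<σⱼ)) = box₀₁ 1 z<s 1<i σᵢ<σ₁<σⱼ
        before 1<i (inj₂ (inj₂ σⱼ<σ₁))   = box₀₂ 1 z<s 1<i (σⱼ<σ₁ , proj₂ (value-bounds (s≤s z≤n) 1≤n))

      occurrence-inside : ∀ {m} → i < m → m < j → at σ m < at σ i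
      occurrence-inside {m} i<m m<j = inside (classify 1≤m m≤n (ℕP.>⇒≢ i<m) (ℕP.<⇒≢ m<j))
        where
        1≤m : 1 ≤ m
        1≤m = ℕP.≤-trans 1≤i (ℕP.<⇒≤ i<m)
        m≤n : m ≤ length σ
        m≤n = ℕP.≤-trans (ℕP.<⇒≤ m<j) j≤n
        inside : Band (at σ m) (at σ i) (at σ j) → at σ m < at σ i
        inside (inj₁ σₘ<σᵢ)          = σₘ<σᵢ
        inside (inj₂ (inj₁ σᵢ<σₘ<σⱼ)) = ⊥-elim (box₁₁ m i<m m<j σᵢ<σₘ<σⱼ)
        inside (inj₂ (inj₂ σⱼ<σₘ))   = ⊥-elim (box₁₂ m i<m m<j (σⱼ<σₘ , proj₂ (value-bounds 1≤m m≤n)))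

      occurrence-after : ∀ {m} → j < m → m ≤ length σ → at σ j < at σ m
      occurrence-after {m} j<m m≤n = after (classify 1≤m m≤n (ℕP.>⇒≢ (ℕP.<-trans i<j j<m)) (ℕP.>⇒≢ j<m))
        where
        1≤m : 1 ≤ m
        1≤m = ℕP.≤-trans j≥1 (ℕP.<⇒≤ j<m)
        after : Band (at σ m) (at σ i) (at σ j) → at σ j < at σ m
        after (inj₁ σₘ<σᵢ)          =
          ⊥-elim (box₂₀ m j<m (s≤s m≤n) (proj₁ (value-bounds 1≤m m≤n) , σₘ<σᵢ))
        after (inj₂ (inj₁ σᵢ<σₘ<σⱼ)) = ⊥-elim (box₂₁ m j<m (s≤s m≤n) σᵢ<σₘ<σⱼ)
        after (inj₂ (inj₂ σⱼ<σₘ))   = σⱼ<σₘ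

    occurrence-unique : ∀ {i j i′ j′} → Occurrence σ i j → Occurrence σ i′ j′ → (i , j) ≡ (i′ , j′)
    occurrence-unique {i} {j} {i′} {j′} o o′
      with occurrence-starts-at-1 o | occurrence-starts-at-1 o′ | ℕP.<-cmp j j′
    ... | refl | refl | tri< j<j′ _ _ =
      ⊥-elim (ℕP.<-asym (Occurrence.σᵢ<σⱼ o) (occurrence-inside o′ (Occurrence.i<j o) j<j′))
    ... | refl | refl | tri≈ _ j≡j′ _ = cong (1 ,_) j≡j′
    ... | refl | refl | tri> _ _ j′<j =
      ⊥-elim (ℕP.<-asym (Occurrence.σᵢ<σⱼ o′) (occurrence-inside o (Occurrence.i<j o′) j′<j))

    p≤1 : p σ ≤ 1
    p≤1 = unique-all-equal⇒length-≤1 (UniqueP.filter⁺ (T? ∘ isOccurrence σ) (occurrencePairs-unique σ))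
            (λ x∈ y∈ → occurrence-unique (∈-occurrences⁻ σ x∈) (∈-occurrences⁻ σ y∈))

    Occurrence⇒p≡1 : ∀ {i j} → Occurrence σ i j → p σ ≡ 1
    Occurrence⇒p≡1 o = ℕP.≤-antisym p≤1 (nonempty (∈-occurrences⁺ σ o))
      where
      nonempty : ∀ {A : Set} {x : A} {xs} → x ∈ xs → 1 ≤ length xs
      nonempty (here _)  = s≤s z≤n
      nonempty (there _) = s≤s z≤n

  p≡1⇒Occurrence : ∀ σ → p σ ≡ 1 → ∃₂ (Occurrence σ)
  p≡1⇒Occurrence σ p≡1 with filterᵇ (isOccurrence σ) (occurrencePairs σ) in eq
  ... | (i , j) ∷ _ = i , j , ∈-occurrences⁻ σ (subst ((i , j) ∈_) (sym eq) (here refl))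

  -- The shape of a permutation containing the pattern

  data Shape : List ℕ → Set where
    shape : ∀ {a b τ ρ} → All (_< a) τ → a < b → All (b <_) ρ → Shape (a ∷ τ ++ b ∷ ρ)

  module Positions (a : ℕ) (τ : List ℕ) (b : ℕ) (ρ : List ℕ) where

    σ : List ℕ
    σ = a ∷ τ ++ b ∷ ρ

    length-σ : length σ ≡ suc (length τ + suc (length ρ))
    length-σ = cong suc (LP.length-++ τ)

    at-middle : at σ (suc (suc (length τ))) ≡ b
    at-middle = go τ
      where
      go : ∀ τ → at (τ ++ b ∷ ρ) (suc (length τ)) ≡ b
      go []      = refl
      go (_ ∷ τ) = go τ

    at-left : ∀ k → k < length τ → at σ (suc (suc k)) ≡ at τ (suc k)
    at-left = at-++ˡ τ (b ∷ ρ)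

    at-right : ∀ k → at σ (suc (suc (suc (length τ + k)))) ≡ at ρ (suc k)
    at-right k = go τ
      where
      go : ∀ τ → at (τ ++ b ∷ ρ) (suc (suc (length τ + k))) ≡ at ρ (suc k)
      go []      = refl
      go (_ ∷ τ) = go τ

    left-position : ∀ {m} → 1 < m → m < suc (suc (length τ)) → ∃ λ k → k < length τ × m ≡ suc (suc k)
    left-position {suc zero}    (s≤s ()) _
    left-position {suc (suc k)} _        (s≤s (s≤s k<)) = k , k< , refl

    right-position : ∀ {m} → suc (suc (length τ)) < m → m ≤ length σ →
                     ∃ λ k → k < length ρ × m ≡ suc (suc (suc (length τ + k)))
    right-position {suc (suc (suc m))} (s≤s (s≤s (s≤s |τ|≤m))) m≤n =
      m ∸ length τ , k<|ρ| , cong (suc ∘ suc ∘ suc) (sym (ℕP.m+[n∸m]≡n |τ|≤m))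
      where
      k<|ρ| : m ∸ length τ < length ρ
      k<|ρ| = ℕP.+-cancelˡ-< (length τ) _ _ (subst (_< length τ + length ρ) (sym (ℕP.m+[n∸m]≡n |τ|≤m)) m<)
        where
        m< : m < length τ + length ρ
        m< = ℕP.≤-pred (subst (suc (suc m) ≤_) (ℕP.+-suc (length τ) (length ρ))
                             (ℕP.≤-pred (subst (suc (suc (suc m)) ≤_) length-σ m≤n)))

    at-left-∈ : ∀ {m} → 1 < m → m < suc (suc (length τ)) → at σ m ∈ τ
    at-left-∈ 1<m m<j with left-position 1<m m<j
    ... | k , k< , refl = subst (_∈ τ) (sym (at-left k k<)) (at-∈ τ k k<)

    at-right-∈ : ∀ {m} → suc (suc (length τ)) < m → m ≤ length σ → at σ m ∈ ρ
    at-right-∈ j<m m≤n with right-position j<m m≤n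
    ... | k , k< , refl = subst (_∈ ρ) (sym (at-right k)) (at-∈ ρ k k<)

    ∈-left⇒position : ∀ {z} → z ∈ τ → ∃ λ m → 1 < m × m < suc (suc (length τ)) × at σ m ≡ z
    ∈-left⇒position z∈ with ∈⇒at z∈
    ... | k , k< , atₖ≡z = suc (suc k) , s<s z<s , s<s (s<s k<) , trans (at-left k k<) atₖ≡z

    ∈-right⇒position : ∀ {z} → z ∈ ρ → ∃ λ m → suc (suc (length τ)) < m × m ≤ length σ × at σ m ≡ z
    ∈-right⇒position z∈ with ∈⇒at z∈
    ... | k , k< , atₖ≡z = m , s<s (s<s (s<s (ℕP.m≤m+n (length τ) k))) , m≤n , trans (at-right k) atₖ≡z
      where
      m : ℕ
      m = suc (suc (suc (length τ + k)))
      m≤n : m ≤ length σ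
      m≤n = subst (m ≤_) (sym length-σ)
              (s≤s (subst (_≤ length τ + suc (length ρ)) (trans (ℕP.+-suc (length τ) (suc k)) (cong suc (ℕP.+-suc (length τ) k)))
                          (ℕP.+-monoʳ-≤ (length τ) (s≤s k<))))

  Shape⇒Occurrence : ∀ {a b τ ρ} → All (_< a) τ → a < b → All (b <_) ρ →
                     Occurrence (a ∷ τ ++ b ∷ ρ) 1 (suc (suc (length τ)))
  Shape⇒Occurrence {a} {b} {τ} {ρ} τ<a a<b b<ρ = record
    { 1≤i   = s≤s z≤n
    ; i<j   = s<s z<s
    ; j≤n   = subst (suc (suc (length τ)) ≤_) (sym length-σ) (s≤s (ℕP.m<m+n (length τ) z<s))
    ; σᵢ<σⱼ = a<σⱼ
    ; box₀₀ = λ _ 0<m m<1 _ → nothing-before-1 0<m m<1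
    ; box₀₁ = λ _ 0<m m<1 _ → nothing-before-1 0<m m<1
    ; box₀₂ = λ _ 0<m m<1 _ → nothing-before-1 0<m m<1
    ; box₁₁ = λ m 1<m m<j (a<σₘ , _) → ℕP.<-asym a<σₘ (left-small 1<m m<j)
    ; box₁₂ = λ m 1<m m<j (b<σₘ , _) → ℕP.<-asym (ℕP.<-trans (left-small 1<m m<j) a<σⱼ) b<σₘ
    ; box₂₀ = λ m j<m m<N (_ , σₘ<a) → ℕP.<-asym σₘ<a (ℕP.<-trans a<b (right-large j<m (ℕP.≤-pred m<N)))
    ; box₂₁ = λ m j<m m<N (_ , σₘ<b) →
                ℕP.<-asym σₘ<b (subst (_< at σ m) (sym at-middle) (right-large j<m (ℕP.≤-pred m<N)))
    }
    where
    open Positions a τ b ρ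
    a<σⱼ : a < at σ (suc (suc (length τ)))
    a<σⱼ = subst (a <_) (sym at-middle) a<b
    nothing-before-1 : ∀ {m} → 0 < m → m < 1 → ⊥
    nothing-before-1 (s≤s _) (s≤s ())
    left-small : ∀ {m} → 1 < m → m < suc (suc (length τ)) → at σ m < a
    left-small 1<m m<j = All.lookup τ<a (at-left-∈ 1<m m<j)
    right-large : ∀ {m} → suc (suc (length τ)) < m → m ≤ length σ → b < at σ m
    right-large j<m m≤n = All.lookup b<ρ (at-right-∈ j<m m≤n)

  split-at : ∀ (xs : List ℕ) k → k < length xs → ∃₂ λ τ y → ∃ λ ρ → xs ≡ τ ++ y ∷ ρ × length τ ≡ k
  split-at (x ∷ xs) zero    _        = [] , x , xs , refl , refl
  split-at (x ∷ xs) (suc k) (s≤s k<) with split-at xs k k<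
  ... | τ , y , ρ , refl , refl = x ∷ τ , y , ρ , refl , refl

  Occurrence⇒Shape : ∀ {n σ j} → IsPerm n σ → Occurrence σ 1 j → Shape σ
  Occurrence⇒Shape {σ = σ} {zero}  _ o = ⊥-elim (ℕP.n≮0 (Occurrence.i<j o))
  Occurrence⇒Shape {σ = σ} {suc zero} _ o = ⊥-elim (ℕP.<-irrefl refl (Occurrence.i<j o))
  Occurrence⇒Shape {σ = x ∷ rest} {suc (suc k)} perm o with split-at rest k (ℕP.≤-pred (Occurrence.j≤n o))
  ... | τ , y , ρ , refl , refl = shape (All.tabulate left-small) x<y (All.tabulate right-large)
    where
    open Positions x τ y ρ
    x<y : x < y
    x<y = subst (x <_) at-middle (Occurrence.σᵢ<σⱼ o)
    left-small : ∀ {z} → z ∈ τ → z < x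
    left-small z∈ with ∈-left⇒position z∈
    ... | m , 1<m , m<j , refl = occurrence-inside perm o 1<m m<j
    right-large : ∀ {z} → z ∈ ρ → y < z
    right-large z∈ with ∈-right⇒position z∈
    ... | m , j<m , m≤n , refl = subst (_< at σ m) at-middle (occurrence-after perm o j<m m≤n)

  perm-∋ : ∀ {n σ v} → IsPerm n σ → InRange n v → v ∈ σ
  perm-∋ {n} {σ} {v} (isPerm |σ|≡n σ-inRange !σ) v-inRange with v ∈? σ
  ... | yes v∈σ = v∈σ
  ... | no  v∉σ = ⊥-elim (ℕP.<⇒≱ (ℕP.n<1+n n) (subst₂ _≤_ (cong suc |σ|≡n) (length-oneTo n) pigeonhole))
    where
    pigeonhole : length (v ∷ σ) ≤ length (oneTo n)
    pigeonhole = unique-⊆⇒length-≤ (All.tabulate (λ z∈σ v≡z → v∉σ (subst (_∈ σ) (sym v≡z) z∈σ)) ∷ !σ)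
      λ { (here refl) → ∈-oneTo⁺ v-inRange ; (there z∈σ) → ∈-oneTo⁺ (All.lookup σ-inRange z∈σ) }

  module ShapeValues {n a b τ ρ} (perm : IsPerm n (a ∷ τ ++ b ∷ ρ))
                     (τ<a : All (_< a) τ) (a<b : a < b) (b<ρ : All (b <_) ρ) where

    private
      b≤n : b ≤ n
      b≤n = proj₂ (All.lookup (IsPerm.inRange perm) (there (∈P.∈-++⁺ʳ τ (here refl))))

      located : ∀ {v} → v ∈ a ∷ τ ++ b ∷ ρ → v ≡ a ⊎ v ∈ τ ⊎ v ≡ b ⊎ v ∈ ρ
      located (here v≡a) = inj₁ v≡a
      located (there v∈) with ∈P.∈-++⁻ τ v∈
      ... | inj₁ v∈τ         = inj₂ (inj₁ v∈τ)
      ... | inj₂ (here v≡b)  = inj₂ (inj₂ (inj₁ v≡b))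
      ... | inj₂ (there v∈ρ) = inj₂ (inj₂ (inj₂ v∈ρ))

      below-a-in-τ : ∀ {v} → 1 ≤ v → v < a → v ∈ τ
      below-a-in-τ {v} 1≤v v<a with located (perm-∋ perm (1≤v , ℕP.≤-trans (ℕP.<⇒≤ (ℕP.<-trans v<a a<b)) b≤n))
      ... | inj₁ refl                = ⊥-elim (ℕP.<-irrefl refl v<a)
      ... | inj₂ (inj₁ v∈τ)          = v∈τ
      ... | inj₂ (inj₂ (inj₁ refl))  = ⊥-elim (ℕP.<-asym v<a a<b)
      ... | inj₂ (inj₂ (inj₂ v∈ρ))   = ⊥-elim (ℕP.<-asym (ℕP.<-trans v<a a<b) (All.lookup b<ρ v∈ρ))

    b≡1+a : b ≡ suc a
    b≡1+a = ℕP.≤-antisym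
      (ℕP.≮⇒≥ λ 1+a<b → gap 1+a<b (located (perm-∋ perm (s≤s z≤n , ℕP.≤-trans (ℕP.<⇒≤ 1+a<b) b≤n)))) a<b
      where
      gap : suc a < b → suc a ≡ a ⊎ suc a ∈ τ ⊎ suc a ≡ b ⊎ suc a ∈ ρ → ⊥
      gap _     (inj₁ 1+a≡a)                = ℕP.1+n≢n 1+a≡a
      gap _     (inj₂ (inj₁ 1+a∈τ))         = ℕP.<-asym (ℕP.n<1+n a) (All.lookup τ<a 1+a∈τ)
      gap 1+a<b (inj₂ (inj₂ (inj₁ 1+a≡b)))  = ℕP.<-irrefl 1+a≡b 1+a<b
      gap 1+a<b (inj₂ (inj₂ (inj₂ 1+a∈ρ)))  = ℕP.<-asym 1+a<b (All.lookup b<ρ 1+a∈ρ)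

    a≡1+|τ| : a ≡ suc (length τ)
    a≡1+|τ| = begin
      a                       ≡⟨ ℕP.suc-pred a ⟨
      suc (pred a)            ≡⟨ cong suc (length-oneTo (pred a)) ⟨
      suc (length (oneTo (pred a))) ≡⟨ cong suc (length-≡-⊆⊇ (oneTo-unique (pred a)) !τ oneTo⊆τ τ⊆oneTo) ⟩
      suc (length τ)          ∎
      where
      open ≡-Reasoning
      instance
        a-nonZero : ℕ.NonZero a
        a-nonZero = ℕ.>-nonZero (proj₁ (All.lookup (IsPerm.inRange perm) (here refl)))
      !τ : Unique τ
      !τ = unique-++⁻ˡ τ (unique-++⁻ʳ (a ∷ []) (IsPerm.unique perm))
      τ⊆oneTo : ∀ {v} → v ∈ τ → v ∈ oneTo (pred a)
      τ⊆oneTo v∈τ = ∈-oneTo⁺ (proj₁ (All.lookup (IsPerm.inRange perm) (there (∈P.∈-++⁺ˡ v∈τ))) ,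
                              ℕP.≤-pred (subst (_ ≤_) (sym (ℕP.suc-pred a)) (All.lookup τ<a v∈τ)))
      oneTo⊆τ : ∀ {v} → v ∈ oneTo (pred a) → v ∈ τ
      oneTo⊆τ v∈ with ∈-oneTo⁻ v∈
      ... | 1≤v , v≤a-1 = below-a-in-τ 1≤v (subst (_ ≤_) (ℕP.suc-pred a) (s≤s v≤a-1))

  infixr 5 _⊞_
  _⊞_ : List ℕ → List ℕ → List ℕ
  α ⊞ π = α ++ map (length α +_) π

  IsPerm-⊞ : ∀ {a k α π} → IsPerm a α → IsPerm k π → IsPerm (a + k) (α ⊞ π)
  IsPerm-⊞ {a} {k} {α} {π} (isPerm refl α-inRange !α) (isPerm refl π-inRange !π) =
    isPerm (trans (LP.length-++ α) (cong (length α +_) (LP.length-map (length α +_) π)))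
           (AllP.++⁺ (All.map (λ (1≤x , x≤a) → 1≤x , ℕP.≤-trans x≤a (ℕP.m≤m+n a k)) α-inRange)
                     (AllP.map⁺ (All.map (λ (1≤x , x≤k) → ℕP.≤-trans 1≤x (ℕP.m≤n+m _ a) , ℕP.+-monoʳ-≤ a x≤k)
                                         π-inRange)))
           (UniqueP.++⁺ !α (UniqueP.map⁺ (ℕP.+-cancelˡ-≡ a _ _) !π) disjoint)
    where
    disjoint : ∀ {v} → v ∈ α × v ∈ map (a +_) π → ⊥
    disjoint (v∈α , v∈shifted) with ∈P.∈-map⁻ (a +_) v∈shifted
    ... | x , x∈π , refl =
      ℕP.<⇒≱ (ℕP.m<m+n a (proj₁ (All.lookup π-inRange x∈π))) (proj₂ (All.lookup α-inRange v∈α))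

  IsPerm-unshift : ∀ {a k} α {β} → IsPerm (a + k) (α ++ β) → length α ≡ a → All (a <_) β →
                   IsPerm k (map (_∸ a) β)
  IsPerm-unshift {a} {k} α {β} (isPerm |αβ|≡a+k inRange unique) refl a<β =
    isPerm (trans (LP.length-map (_∸ a) β) (ℕP.+-cancelˡ-≡ a _ _ (trans (sym (LP.length-++ α)) |αβ|≡a+k)))
           (AllP.map⁺ (All.zipWith unshift-inRange (a<β , AllP.++⁻ʳ α inRange)))
           (unique-map⁺ (_∸ a) (λ x∈ y∈ → ℕP.∸-cancelʳ-≡ (ℕP.<⇒≤ (All.lookup a<β x∈))
                                                         (ℕP.<⇒≤ (All.lookup a<β y∈)))
                        (unique-++⁻ʳ α unique))
    where
    unshift-inRange : ∀ {x} → a < x × InRange (a + k) x → InRange k (x ∸ a)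
    unshift-inRange {x} (a<x , _ , x≤a+k) =
      ℕP.m<n⇒0<n∸m a<x , subst (x ∸ a ≤_) (ℕP.m+n∸m≡n a k) (ℕP.∸-monoˡ-≤ a x≤a+k)

  IsPerm-max-head : ∀ {n w} → IsPerm n (n ∷ w) → All (_< n) w
  IsPerm-max-head (isPerm _ (_ ∷ w-inRange) (n∉w ∷ _)) =
    All.tabulate (λ z∈ → ℕP.≤∧≢⇒< (proj₂ (All.lookup w-inRange z∈)) (All.lookup n∉w z∈ ∘ sym))

  IsPerm-min-head : ∀ {n w} → IsPerm n (1 ∷ w) → All (1 <_) w
  IsPerm-min-head (isPerm _ (_ ∷ w-inRange) (1∉w ∷ _)) =
    All.tabulate (λ z∈ → ℕP.≤∧≢⇒< (proj₁ (All.lookup w-inRange z∈)) (All.lookup 1∉w z∈))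

  -- King permutations by their first entry

  startsWith : ℕ → List ℕ → Bool
  startsWith x []      = false
  startsWith x (y ∷ _) = x ≡ᵇ y

  K-startingWith K-notStartingWith : ℕ → ℕ → List (List ℕ)
  K-startingWith    x n = filterᵇ (startsWith x) (K n)
  K-notStartingWith x n = filterᵇ (not ∘ startsWith x) (K n)

  startsWith⇒∷ : ∀ {x σ} → T (startsWith x σ) → ∃ λ w → σ ≡ x ∷ w
  startsWith⇒∷ {x} {y ∷ w} x≡ᵇy = w , cong (_∷ w) (sym (ℕP.≡ᵇ⇒≡ x y x≡ᵇy))

  startsWith-∷ : ∀ x w → T (startsWith x (x ∷ w))
  startsWith-∷ x w = ℕP.≡⇒≡ᵇ x x refl

  length-K-split : ∀ x n → length (K-startingWith x n) + length (K-notStartingWith x n) ≡ length (K n)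
  length-K-split x n = length-filterᵇ-not (startsWith x) (K n)

  K-startingWith-unique : ∀ x n → Unique (K-startingWith x n)
  K-startingWith-unique x n = UniqueP.filter⁺ (T? ∘ startsWith x) (K-unique n)

  K-notStartingWith-unique : ∀ x n → Unique (K-notStartingWith x n)
  K-notStartingWith-unique x n = UniqueP.filter⁺ (T? ∘ not ∘ startsWith x) (K-unique n)

  ∈-K-startingWith⁻ : ∀ {x n σ} → σ ∈ K-startingWith x n → ∃ λ w → σ ≡ x ∷ w × IsPerm n σ × King σ
  ∈-K-startingWith⁻ {x} {n} {σ} σ∈ with ∈P.∈-filter⁻ (T? ∘ startsWith x) {xs = K n} σ∈
  ... | σ∈K , starts with startsWith⇒∷ {x} {σ} starts
  ... | w , refl = w , refl , ∈K⁻ n σ∈K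

  ∈-K-startingWith⁺ : ∀ {x n w} → IsPerm n (x ∷ w) → King (x ∷ w) → x ∷ w ∈ K-startingWith x n
  ∈-K-startingWith⁺ {x} {n} {w} perm king = ∈P.∈-filter⁺ (T? ∘ startsWith x) (∈K⁺ n perm king) (startsWith-∷ x w)

  ∈-K-notStartingWith⁻ : ∀ {x n σ} → σ ∈ K-notStartingWith x n → IsPerm n σ × King σ × ¬ T (startsWith x σ)
  ∈-K-notStartingWith⁻ {x} {n} σ∈ with ∈P.∈-filter⁻ (T? ∘ not ∘ startsWith x) {xs = K n} σ∈
  ... | σ∈K , not-starts = proj₁ (∈K⁻ n σ∈K) , proj₂ (∈K⁻ n σ∈K) , T-not⇒¬T not-starts

  ∈-K-notStartingWith⁺ : ∀ {x n σ} → IsPerm n σ → King σ → ¬ T (startsWith x σ) → σ ∈ K-notStartingWith x n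
  ∈-K-notStartingWith⁺ {x} {n} perm king not-starts =
    ∈P.∈-filter⁺ (T? ∘ not ∘ startsWith x) (∈K⁺ n perm king) (¬T⇒T-not not-starts)

  length-K-startingWith-max : ∀ m → length (K-notStartingWith m m) ≡ length (K-startingWith (suc m) (suc m))
  length-K-startingWith-max m =
    length-≡-bijection (suc m ∷_) (K-notStartingWith-unique m m) (K-startingWith-unique (suc m) (suc m))
                       into (λ _ _ → LP.∷-injectiveʳ) onto
    where
    into : ∀ {τ} → τ ∈ K-notStartingWith m m → suc m ∷ τ ∈ K-startingWith (suc m) (suc m)
    into {τ} τ∈ with ∈-K-notStartingWith⁻ {m} {m} τ∈
    ... | isPerm |τ|≡m τ-inRange !τ , king-τ , not-m =
      ∈-K-startingWith⁺ (isPerm (cong suc |τ|≡m) ((s≤s z≤n , ℕP.≤-refl) ∷ All.map (λ (1≤x , x≤m) → 1≤x , ℕP.m≤n⇒m≤1+n x≤m) τ-inRange)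
                                (1+m∉τ ∷ !τ))
                        (king-∷ τ-inRange king-τ not-m)
      where
      1+m∉τ : All (suc m ≢_) τ
      1+m∉τ = All.tabulate (λ x∈ 1+m≡x → ℕP.<⇒≢ (s≤s (proj₂ (All.lookup τ-inRange x∈))) (sym 1+m≡x))
      king-∷ : ∀ {τ} → All (InRange m) τ → King τ → ¬ T (startsWith m τ) → King (suc m ∷ τ)
      king-∷ []                    _      _     = [-]
      king-∷ ((_ , t≤m) ∷ _) king-τ not-m =
        Apart-sym (<⇒Apart (s≤s (ℕP.≤∧≢⇒< t≤m (λ t≡m → not-m (ℕP.≡⇒≡ᵇ m _ (sym t≡m)))))) ∷ king-τ
    onto : ∀ {σ} → σ ∈ K-startingWith (suc m) (suc m) → ∃ λ τ → τ ∈ K-notStartingWith m m × suc m ∷ τ ≡ σ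
    onto σ∈ with ∈-K-startingWith⁻ {suc m} {suc m} σ∈
    ... | τ , refl , perm@(isPerm |σ|≡1+m (_ ∷ τ-inRange) (_ ∷ !τ)) , king-σ =
      τ , ∈-K-notStartingWith⁺ (isPerm (ℕP.suc-injective |σ|≡1+m) τ-inRange′ !τ) (Linked.tail king-σ) (not-m king-σ) ,
      refl
      where
      τ-inRange′ : All (InRange m) τ
      τ-inRange′ =
        All.tabulate (λ x∈ → proj₁ (All.lookup τ-inRange x∈) , ℕP.≤-pred (All.lookup (IsPerm-max-head perm) x∈))
      not-m : ∀ {τ} → King (suc m ∷ τ) → ¬ T (startsWith m τ)
      not-m {t ∷ _} (apart ∷ _) m≡ᵇt = proj₁ (proj₂ apart) (cong suc (ℕP.≡ᵇ⇒≡ m t m≡ᵇt))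

  length-K-startingWith-min : ∀ j → length (K-notStartingWith 1 j) ≡ length (K-startingWith 1 (suc j))
  length-K-startingWith-min j =
    length-≡-bijection ((1 ∷ []) ⊞_) (K-notStartingWith-unique 1 j) (K-startingWith-unique 1 (suc j))
                       into (λ _ _ → LP.map-injective ℕP.suc-injective ∘ LP.∷-injectiveʳ) onto
    where
    into : ∀ {ρ} → ρ ∈ K-notStartingWith 1 j → (1 ∷ []) ⊞ ρ ∈ K-startingWith 1 (suc j)
    into ρ∈ with ∈-K-notStartingWith⁻ {1} {j} ρ∈
    ... | perm , king-ρ , not-1 =
      ∈-K-startingWith⁺ (IsPerm-⊞ (isPerm refl ((s≤s z≤n , s≤s z≤n) ∷ []) ([] ∷ [])) perm)
                        (king-1∷ (IsPerm.inRange perm) king-ρ not-1)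
      where
      king-1∷ : ∀ {ρ} → All (InRange j) ρ → King ρ → ¬ T (startsWith 1 ρ) → King (1 ∷ map suc ρ)
      king-1∷ []                    _      _     = [-]
      king-1∷ {r ∷ _} ((1≤r , _) ∷ _) king-ρ not-1 =
        <⇒Apart (s≤s (ℕP.≤∧≢⇒< 1≤r (not-1 ∘ ℕP.≡⇒≡ᵇ 1 r))) ∷ king-shift 1 king-ρ
    onto : ∀ {σ} → σ ∈ K-startingWith 1 (suc j) → ∃ λ ρ → ρ ∈ K-notStartingWith 1 j × (1 ∷ []) ⊞ ρ ≡ σ
    onto σ∈ with ∈-K-startingWith⁻ {1} {suc j} σ∈
    ... | ρ′ , refl , perm , king-σ =
      map (_∸ 1) ρ′ ,
      ∈-K-notStartingWith⁺ (IsPerm-unshift (1 ∷ []) perm refl 1<ρ′) (king-unshift 1 1<ρ′ (Linked.tail king-σ))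
                           (not-1 king-σ 1<ρ′) ,
      cong (1 ∷_) (shift-unshift 1 1<ρ′)
      where
      1<ρ′ : All (1 <_) ρ′
      1<ρ′ = IsPerm-min-head perm
      not-1 : ∀ {ρ′} → King (1 ∷ ρ′) → All (1 <_) ρ′ → ¬ T (startsWith 1 (map (_∸ 1) ρ′))
      not-1 {suc r ∷ _} (apart ∷ _) _ 1≡ᵇr = proj₁ apart (cong suc (sym (ℕP.≡ᵇ⇒≡ 1 r 1≡ᵇr)))

  K-occurring : ℕ → List (List ℕ)
  K-occurring n = filterᵇ (λ σ → p σ ≡ᵇ 1) (K n)

  firstEntry : List ℕ → ℕ
  firstEntry []      = 0
  firstEntry (x ∷ _) = x

  -- First entry m + 2; smaller first entries do not occur (shape-first-entry), so the truncated subtraction is harmless.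
  K-occurringFrom : ℕ → ℕ → List (List ℕ)
  K-occurringFrom m n = filterᵇ (λ σ → firstEntry σ ∸ 2 ≡ᵇ m) (K-occurring n)

  ∈-K-occurring⁻ : ∀ {n σ} → σ ∈ K-occurring n → IsPerm n σ × King σ × Shape σ
  ∈-K-occurring⁻ {n} {σ} σ∈ with ∈P.∈-filter⁻ (T? ∘ (λ σ → p σ ≡ᵇ 1)) {xs = K n} σ∈
  ... | σ∈K , p≡ᵇ1 with ∈K⁻ n σ∈K | p≡1⇒Occurrence σ (ℕP.≡ᵇ⇒≡ (p σ) 1 p≡ᵇ1)
  ... | perm , king | i , j , o with occurrence-starts-at-1 perm o
  ... | refl = perm , king , Occurrence⇒Shape perm o

  ∈-K-occurring⁺ : ∀ {n a b τ ρ} → IsPerm n (a ∷ τ ++ b ∷ ρ) → King (a ∷ τ ++ b ∷ ρ) →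
                   All (_< a) τ → a < b → All (b <_) ρ → a ∷ τ ++ b ∷ ρ ∈ K-occurring n
  ∈-K-occurring⁺ {n} perm king τ<a a<b b<ρ = ∈P.∈-filter⁺ (T? ∘ (λ σ → p σ ≡ᵇ 1)) (∈K⁺ n perm king)
    (ℕP.≡⇒≡ᵇ _ 1 (Occurrence⇒p≡1 perm (Shape⇒Occurrence τ<a a<b b<ρ)))

  -- τ is nonempty because the adjacent entries a and b = a + 1 of a king permutation must differ by more than 1.
  shape-first-entry : ∀ {n a b τ ρ} → IsPerm n (a ∷ τ ++ b ∷ ρ) → King (a ∷ τ ++ b ∷ ρ) →
                      All (_< a) τ → a < b → All (b <_) ρ → 2 ≤ a × a < n
  shape-first-entry perm king τ<a a<b b<ρ
    with ShapeValues.b≡1+a perm τ<a a<b b<ρ | ShapeValues.a≡1+|τ| perm τ<a a<b b<ρ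
  shape-first-entry {τ = []}    perm (apart ∷ _) _ _ _ | refl | refl = ⊥-elim (proj₁ apart refl)
  shape-first-entry {n} {τ = t ∷ τ} {ρ} perm king _ _ _ | refl | refl = s≤s (s≤s z≤n) , a<n
    where
    a : ℕ
    a = suc (suc (length τ))
    a<n : a < n
    a<n = subst (a <_) (trans (sym (Positions.length-σ a (t ∷ τ) (suc a) ρ)) (IsPerm.length≡ perm))
                (s<s (s<s (ℕP.m<m+n (length τ) z<s)))

  ⊞-∈-K-occurringFrom : ∀ {m k α π} → α ∈ K-startingWith (suc (suc m)) (suc (suc m)) → π ∈ K-startingWith 1 k →
                        α ⊞ π ∈ K-occurringFrom m (suc (suc m) + k)
  ⊞-∈-K-occurringFrom {m} {k} α∈ π∈
    with ∈-K-startingWith⁻ {suc (suc m)} {suc (suc m)} α∈ | ∈-K-startingWith⁻ {1} {k} π∈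
  ... | [] , refl , α-perm , _ | _ = ⊥-elim (ℕP.0≢1+n (ℕP.suc-injective (IsPerm.length≡ α-perm)))
  ... | t ∷ τ , refl , α-perm , apart ∷ king-τ | ρ , refl , π-perm , π-king =
    ∈P.∈-filter⁺ (T? ∘ (λ σ → firstEntry σ ∸ 2 ≡ᵇ m))
      (∈-K-occurring⁺ (IsPerm-⊞ α-perm π-perm) (apart ∷ king-++ king-τ (All.map apart-b τ<a) (king-shift c π-king))
                      τ<a a<b b<ρ)
      (ℕP.≡⇒≡ᵇ m m refl)
    where
    a c : ℕ
    a = suc (suc m)
    c = length (a ∷ t ∷ τ)
    c≡a : c ≡ a
    c≡a = IsPerm.length≡ α-perm
    τ<a : All (_< a) (t ∷ τ)
    τ<a = IsPerm-max-head α-perm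
    a<b : a < c + 1
    a<b = subst₂ _≤_ (cong suc c≡a) (ℕP.+-comm 1 c) ℕP.≤-refl
    apart-b : ∀ {z} → z < a → Apart z (c + 1)
    apart-b {z} z<a = <⇒Apart (subst (suc z <_) (ℕP.+-comm 1 c) (s≤s (subst (z <_) (sym c≡a) z<a)))
    b<ρ : All (c + 1 <_) (map (c +_) ρ)
    b<ρ = AllP.map⁺ (All.map (ℕP.+-monoʳ-< c) (IsPerm-min-head π-perm))

  decompose-shape : ∀ {m k σ} → IsPerm (suc (suc m) + k) σ → King σ → T (firstEntry σ ∸ 2 ≡ᵇ m) → Shape σ →
    ∃₂ λ α π → α ∈ K-startingWith (suc (suc m)) (suc (suc m)) × π ∈ K-startingWith 1 k × α ⊞ π ≡ σ
  decompose-shape perm king _ (shape {τ = []} τ<x x<y y<ρ) =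
    ⊥-elim (proj₁ (Linked.head king) (ShapeValues.b≡1+a perm τ<x x<y y<ρ))
  decompose-shape {m} {k} perm king key (shape {x} {y} {t ∷ τ′} {ρ} τ<x x<y y<ρ)
    with ShapeValues.b≡1+a perm τ<x x<y y<ρ | ShapeValues.a≡1+|τ| perm τ<x x<y y<ρ
  ... | refl | refl with ℕP.≡ᵇ⇒≡ (length τ′) m key
  ... | refl =
    x ∷ t ∷ τ′ , 1 ∷ map (_∸ x) ρ ,
    ∈-K-startingWith⁺ α-perm (king-++⁻ˡ (x ∷ t ∷ τ′) {suc x ∷ ρ} king) ,
    ∈-K-startingWith⁺ (subst (IsPerm k) unshift≡ (IsPerm-unshift {x} {k} (x ∷ t ∷ τ′) perm refl x<β))
                      (subst King unshift≡ (king-unshift x x<β (king-++⁻ʳ (x ∷ t ∷ τ′) {suc x ∷ ρ} king))) ,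
    trans (cong ((x ∷ t ∷ τ′) ⊞_) (sym unshift≡)) (cong ((x ∷ t ∷ τ′) ++_) (shift-unshift x x<β))
    where
    x<β : All (x <_) (suc x ∷ ρ)
    x<β = ℕP.n<1+n x ∷ All.map (ℕP.<-trans (ℕP.n<1+n x)) y<ρ
    unshift≡ : map (_∸ x) (suc x ∷ ρ) ≡ 1 ∷ map (_∸ x) ρ
    unshift≡ = cong (_∷ map (_∸ x) ρ) (ℕP.m+n∸n≡m 1 x)
    τ-inRange : All (InRange (suc (suc m) + k)) (t ∷ τ′)
    τ-inRange = AllP.++⁻ˡ (t ∷ τ′) {suc x ∷ ρ} (All.tail (IsPerm.inRange perm))
    α-perm : IsPerm x (x ∷ t ∷ τ′)
    α-perm = isPerm refl ((s≤s z≤n , ℕP.≤-refl) ∷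
                          All.tabulate (λ z∈ → proj₁ (All.lookup τ-inRange z∈) , ℕP.<⇒≤ (All.lookup τ<x z∈)))
                    (unique-++⁻ˡ (x ∷ t ∷ τ′) {suc x ∷ ρ} (IsPerm.unique perm))

  K-occurringFrom-decompose : ∀ {m k σ} → σ ∈ K-occurringFrom m (suc (suc m) + k) →
    ∃₂ λ α π → α ∈ K-startingWith (suc (suc m)) (suc (suc m)) × π ∈ K-startingWith 1 k × α ⊞ π ≡ σ
  K-occurringFrom-decompose {m} {k} {σ} σ∈ =
    let σ∈occ , key = ∈P.∈-filter⁻ (T? ∘ (λ σ → firstEntry σ ∸ 2 ≡ᵇ m)) {xs = K-occurring (suc (suc m) + k)}
                                   σ∈
        perm , king , σ-shape = ∈-K-occurring⁻ {suc (suc m) + k} σ∈occ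
    in decompose-shape perm king key σ-shape

  ⊞-injective : ∀ {α α′ π π′} → length α ≡ length α′ → α ⊞ π ≡ α′ ⊞ π′ → α ≡ α′ × π ≡ π′
  ⊞-injective {α} {α′} |α|≡|α′| eq with ++-injective-length α α′ |α|≡|α′| eq
  ... | refl , shifted≡ = refl , LP.map-injective (ℕP.+-cancelˡ-≡ (length α) _ _) shifted≡

  length-K-occurringFrom : ∀ m k → length (K-occurringFrom m (suc (suc m) + k)) ≡
                           length (K-startingWith (suc (suc m)) (suc (suc m))) * length (K-startingWith 1 k)
  length-K-occurringFrom m k = begin
    length (K-occurringFrom m (a + k))
      ≡⟨ length-≡-bijection (uncurry _⊞_) pairs-unique occurringFrom-unique into inj onto ⟨
    length (cartesianProduct Kₐ K₁)
      ≡⟨ length-cartesianProduct Kₐ K₁ ⟩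
    length Kₐ * length K₁ ∎
    where
    open ≡-Reasoning
    a : ℕ
    a = suc (suc m)
    Kₐ K₁ : List (List ℕ)
    Kₐ = K-startingWith a a
    K₁ = K-startingWith 1 k
    pairs-unique : Unique (cartesianProduct Kₐ K₁)
    pairs-unique = UniqueP.cartesianProduct⁺ (K-startingWith-unique a a) (K-startingWith-unique 1 k)
    occurringFrom-unique : Unique (K-occurringFrom m (a + k))
    occurringFrom-unique =
      UniqueP.filter⁺ (T? ∘ (λ σ → firstEntry σ ∸ 2 ≡ᵇ m)) (UniqueP.filter⁺ (T? ∘ (λ σ → p σ ≡ᵇ 1)) (K-unique (a + k)))
    into : ∀ {απ} → απ ∈ cartesianProduct Kₐ K₁ → uncurry _⊞_ απ ∈ K-occurringFrom m (a + k)
    into απ∈ with ∈P.∈-cartesianProduct⁻ Kₐ K₁ απ∈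
    ... | α∈ , π∈ = ⊞-∈-K-occurringFrom {m} {k} α∈ π∈
    length-α : ∀ {απ} → απ ∈ cartesianProduct Kₐ K₁ → length (proj₁ απ) ≡ a
    length-α απ∈ with ∈-K-startingWith⁻ {a} {a} (proj₁ (∈P.∈-cartesianProduct⁻ Kₐ K₁ απ∈))
    ... | _ , _ , α-perm , _ = IsPerm.length≡ α-perm
    inj : ∀ {απ απ′} → απ ∈ cartesianProduct Kₐ K₁ → απ′ ∈ cartesianProduct Kₐ K₁ →
          uncurry _⊞_ απ ≡ uncurry _⊞_ απ′ → απ ≡ απ′
    inj {α , π} {α′ , π′} απ∈ απ′∈ eq with ⊞-injective {α} {α′} (trans (length-α απ∈) (sym (length-α απ′∈))) eq
    ... | refl , refl = refl
    onto : ∀ {σ} → σ ∈ K-occurringFrom m (a + k) →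
           ∃ λ απ → απ ∈ cartesianProduct Kₐ K₁ × uncurry _⊞_ απ ≡ σ
    onto σ∈ = let α , π , α∈ , π∈ , α⊞π≡σ = K-occurringFrom-decompose {m} {k} σ∈ in
              (α , π) , ∈P.∈-cartesianProduct⁺ α∈ π∈ , α⊞π≡σ

  prepend : List ℕ → List (List ℕ) → List (List ℕ)
  prepend xs ws = concatMap (λ x → map (x ∷_) ws) xs

  wordsOver : ℕ → List ℕ → List (List ℕ)
  wordsOver zero    xs = [] ∷ []
  wordsOver (suc k) xs = prepend xs (wordsOver k xs)

  without : ℕ → List ℕ → List ℕ
  without x = filterᵇ (λ y → not (x ≡ᵇ y))

  -- words n n has nⁿ entries, arrangements n (oneTo n) only the n! permutations: this makes A n computable for n ≤ 8.
  arrangements : ℕ → List ℕ → List (List ℕ)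
  arrangements zero    xs = [] ∷ []
  arrangements (suc k) xs = concatMap (λ x → map (x ∷_) (arrangements k (without x xs))) xs

  fresh : ℕ → List ℕ → Bool
  fresh x w = not (any (x ≡ᵇ_) w)

  filterᵇ-fresh-prepend : ∀ x xs ws → filterᵇ (fresh x) (prepend xs ws) ≡ prepend (without x xs) (filterᵇ (fresh x) ws)
  filterᵇ-fresh-prepend x []       ws = refl
  filterᵇ-fresh-prepend x (y ∷ xs) ws = begin
    filterᵇ (fresh x) (map (y ∷_) ws ++ prepend xs ws)
      ≡⟨ LP.filter-++ (T? ∘ fresh x) (map (y ∷_) ws) (prepend xs ws) ⟩
    filterᵇ (fresh x) (map (y ∷_) ws) ++ filterᵇ (fresh x) (prepend xs ws)
      ≡⟨ cong₂ _++_ (filterᵇ-map (fresh x) (y ∷_) ws) (filterᵇ-fresh-prepend x xs ws) ⟩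
    map (y ∷_) (filterᵇ (λ w → not ((x ≡ᵇ y) ∨ any (x ≡ᵇ_) w)) ws) ++ prepend (without x xs) fresh-ws
      ≡⟨ first-letter ⟩
    prepend (without x (y ∷ xs)) fresh-ws ∎
    where
    open ≡-Reasoning
    fresh-ws : List (List ℕ)
    fresh-ws = filterᵇ (fresh x) ws
    first-letter : map (y ∷_) (filterᵇ (λ w → not ((x ≡ᵇ y) ∨ any (x ≡ᵇ_) w)) ws) ++ prepend (without x xs) fresh-ws
                   ≡ prepend (without x (y ∷ xs)) fresh-ws
    first-letter with x ≡ᵇ y
    ... | true  = cong (λ ws′ → map (y ∷_) ws′ ++ prepend (without x xs) fresh-ws)
                       (LP.filter-none (T? ∘ (λ _ → false)) (All.universal (λ _ ()) ws))
    ... | false = refl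

  filterᵇ-fresh-wordsOver : ∀ x k xs → filterᵇ (fresh x) (wordsOver k xs) ≡ wordsOver k (without x xs)
  filterᵇ-fresh-wordsOver x zero    xs = refl
  filterᵇ-fresh-wordsOver x (suc k) xs =
    trans (filterᵇ-fresh-prepend x xs (wordsOver k xs)) (cong (prepend (without x xs)) (filterᵇ-fresh-wordsOver x k xs))

  filterᵇ-distinct-prepend : ∀ xs ws →
    filterᵇ distinct (prepend xs ws) ≡ concatMap (λ x → map (x ∷_) (filterᵇ distinct (filterᵇ (fresh x) ws))) xs
  filterᵇ-distinct-prepend []       ws = refl
  filterᵇ-distinct-prepend (x ∷ xs) ws = begin
    filterᵇ distinct (map (x ∷_) ws ++ prepend xs ws)
      ≡⟨ LP.filter-++ (T? ∘ distinct) (map (x ∷_) ws) (prepend xs ws) ⟩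
    filterᵇ distinct (map (x ∷_) ws) ++ filterᵇ distinct (prepend xs ws)
      ≡⟨ cong₂ _++_ (trans (filterᵇ-map distinct (x ∷_) ws) (cong (map (x ∷_)) (filterᵇ-∧ (fresh x) distinct ws)))
                    (filterᵇ-distinct-prepend xs ws) ⟩
    map (x ∷_) (filterᵇ distinct (filterᵇ (fresh x) ws)) ++
    concatMap (λ x → map (x ∷_) (filterᵇ distinct (filterᵇ (fresh x) ws))) xs ∎
    where open ≡-Reasoning

  filterᵇ-distinct-wordsOver : ∀ k xs → filterᵇ distinct (wordsOver k xs) ≡ arrangements k xs
  filterᵇ-distinct-wordsOver zero    xs = refl
  filterᵇ-distinct-wordsOver (suc k) xs =
    trans (filterᵇ-distinct-prepend xs (wordsOver k xs))
          (LP.concatMap-cong (λ x → cong (map (x ∷_)) (trans (cong (filterᵇ distinct) (filterᵇ-fresh-wordsOver x k xs))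
                                                              (filterᵇ-distinct-wordsOver k (without x xs)))) xs)

  words≡wordsOver : ∀ k n → words k n ≡ wordsOver k (oneTo n)
  words≡wordsOver zero    n = refl
  words≡wordsOver (suc k) n = cong (prepend (oneTo n)) (words≡wordsOver k n)

open KingPermutations
open import Data.Integer as ℤ using (ℤ; +_; -_; _+_; _*_; _-_)
open +-*-Solver using (solve; _:+_; _:*_; _:-_; _:=_; con)

∑ : ℕ → (ℕ → ℤ) → ℤ
∑ zero    f = + 0
∑ (suc n) f = f 0 + ∑ n (f ∘ suc)

sumℤ-map-applyUpTo : ∀ (f : ℕ → ℤ) g n → sumℤ (map f (applyUpTo g n)) ≡ ∑ n (f ∘ g)
sumℤ-map-applyUpTo f g zero    = refl
sumℤ-map-applyUpTo f g (suc n) = cong (_+_ (f (g 0))) (sumℤ-map-applyUpTo f (g ∘ suc) n)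

∑-cong : ∀ n {f g : ℕ → ℤ} → (∀ i → i < n → f i ≡ g i) → ∑ n f ≡ ∑ n g
∑-cong zero    eq = refl
∑-cong (suc n) eq = cong₂ _+_ (eq 0 z<s) (∑-cong n (λ i i<n → eq (suc i) (s<s i<n)))

∑-zero : ∀ n {f : ℕ → ℤ} → (∀ i → i < n → f i ≡ + 0) → ∑ n f ≡ + 0
∑-zero zero    eq = refl
∑-zero (suc n) eq = cong₂ _+_ (eq 0 z<s) (∑-zero n (λ i i<n → eq (suc i) (s<s i<n)))

∑-+ : ∀ n (f g : ℕ → ℤ) → ∑ n (λ i → f i + g i) ≡ ∑ n f + ∑ n g
∑-+ zero    f g = refl
∑-+ (suc n) f g = begin
  (f 0 + g 0) + ∑ n (λ i → f (suc i) + g (suc i))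
    ≡⟨ cong (_+_ (f 0 + g 0)) (∑-+ n (f ∘ suc) (g ∘ suc)) ⟩
  (f 0 + g 0) + (∑ n (f ∘ suc) + ∑ n (g ∘ suc))
    ≡⟨ solve 4 (λ a b c d → (a :+ b) :+ (c :+ d) := (a :+ c) :+ (b :+ d)) refl
               (f 0) (g 0) (∑ n (f ∘ suc)) (∑ n (g ∘ suc)) ⟩
  (f 0 + ∑ n (f ∘ suc)) + (g 0 + ∑ n (g ∘ suc)) ∎
  where open ≡-Reasoning

∑-neg : ∀ n (f : ℕ → ℤ) → ∑ n (λ i → - f i) ≡ - ∑ n f
∑-neg zero    f = refl
∑-neg (suc n) f = trans (cong (_+_ (- f 0)) (∑-neg n (f ∘ suc))) (sym (ℤP.neg-distrib-+ (f 0) _))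

∑-*ˡ : ∀ n c (f : ℕ → ℤ) → ∑ n (λ i → c * f i) ≡ c * ∑ n f
∑-*ˡ zero    c f = sym (ℤP.*-zeroʳ c)
∑-*ˡ (suc n) c f = trans (cong (_+_ (c * f 0)) (∑-*ˡ n c (f ∘ suc))) (sym (ℤP.*-distribˡ-+ c (f 0) _))

∑-*ʳ : ∀ n c (f : ℕ → ℤ) → ∑ n (λ i → f i * c) ≡ ∑ n f * c
∑-*ʳ n c f = trans (∑-cong n (λ i _ → ℤP.*-comm (f i) c)) (trans (∑-*ˡ n c f) (ℤP.*-comm c _))

∑-last : ∀ n (f : ℕ → ℤ) → ∑ (suc n) f ≡ ∑ n f + f n
∑-last zero    f = ℤP.+-comm (f 0) (+ 0)
∑-last (suc n) f = trans (cong (_+_ (f 0)) (∑-last n (f ∘ suc))) (sym (ℤP.+-assoc (f 0) _ _))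

∑-reverse : ∀ n (f : ℕ → ℤ) → ∑ n f ≡ ∑ n (λ i → f (n ∸ suc i))
∑-reverse zero    f = refl
∑-reverse (suc n) f = begin
  f 0 + ∑ n (f ∘ suc)                      ≡⟨ cong (_+_ (f 0)) (∑-reverse n (f ∘ suc)) ⟩
  f 0 + ∑ n (λ i → f (suc (n ∸ suc i)))    ≡⟨ ℤP.+-comm (f 0) _ ⟩
  ∑ n (λ i → f (suc (n ∸ suc i))) + f 0    ≡⟨ cong₂ _+_ (∑-cong n (λ i i<n → cong f (sym (ℕP.+-∸-assoc 1 i<n))))
                                                          (cong f (sym (ℕP.n∸n≡0 n))) ⟩
  ∑ n (λ i → f (n ∸ i)) + f (n ∸ n)        ≡⟨ sym (∑-last n (λ i → f (n ∸ i))) ⟩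
  ∑ (suc n) (λ i → f (n ∸ i))              ∎
  where open ≡-Reasoning

-- Both sides sum F j k over the pairs with j + k ≤ n.
∑-triangle : ∀ n (F : ℕ → ℕ → ℤ) →
             ∑ (suc n) (λ i → ∑ (suc i) (λ j → F j (i ∸ j))) ≡ ∑ (suc n) (λ j → ∑ (suc (n ∸ j)) (F j))
∑-triangle zero    F = refl
∑-triangle (suc n) F = begin
  (F 0 0 + + 0) + ∑ (suc n) (λ i → F 0 (suc i) + ∑ (suc i) (λ j → F (suc j) (i ∸ j)))
    ≡⟨ cong (_+_ (F 0 0 + + 0)) (∑-+ (suc n) (F 0 ∘ suc) (λ i → ∑ (suc i) (λ j → F (suc j) (i ∸ j)))) ⟩
  (F 0 0 + + 0) + (∑ (suc n) (F 0 ∘ suc) + ∑ (suc n) (λ i → ∑ (suc i) (λ j → F (suc j) (i ∸ j))))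
    ≡⟨ cong (λ x → F 0 0 + + 0 + (∑ (suc n) (F 0 ∘ suc) + x)) (∑-triangle n (F ∘ suc)) ⟩
  (F 0 0 + + 0) + (∑ (suc n) (F 0 ∘ suc) + ∑ (suc n) (λ j → ∑ (suc (n ∸ j)) (F (suc j))))
    ≡⟨ solve 3 (λ a b c → (a :+ con (+ 0)) :+ (b :+ c) := (a :+ b) :+ c) refl
               (F 0 0) (∑ (suc n) (F 0 ∘ suc)) (∑ (suc n) (λ j → ∑ (suc (n ∸ j)) (F (suc j)))) ⟩
  (F 0 0 + ∑ (suc n) (F 0 ∘ suc)) + ∑ (suc n) (λ j → ∑ (suc (n ∸ j)) (F (suc j))) ∎
  where open ≡-Reasoning

∑-only-last : ∀ n (f : ℕ → ℤ) → (∀ i → i < n → f i ≡ + 0) → ∑ (suc n) f ≡ f n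
∑-only-last n f f≡0 = trans (∑-last n f) (trans (cong (_+ f n) (∑-zero n f≡0)) (ℤP.+-identityˡ (f n)))

∑-only-first : ∀ n (f : ℕ → ℤ) → (∀ i → i < n → f (suc i) ≡ + 0) → ∑ (suc n) f ≡ f 0
∑-only-first n f f≡0 = trans (cong (_+_ (f 0)) (∑-zero n f≡0)) (ℤP.+-identityʳ (f 0))

indicator : Bool → ℤ
indicator b = if b then + 1 else + 0

∑-indicator-≡ᵇ : ∀ N k → k < N → ∑ N (λ m → indicator (k ≡ᵇ m)) ≡ + 1
∑-indicator-≡ᵇ (suc N) zero    _         = cong (_+_ (+ 1)) (∑-zero N (λ _ _ → refl))
∑-indicator-≡ᵇ (suc N) (suc k) (s≤s k<N) = trans (ℤP.+-identityˡ _) (∑-indicator-≡ᵇ N k k<N)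

module _ {A : Set} where

  length-filterᵇ-∷ : ∀ (q : A → Bool) x xs →
                     + length (filterᵇ q (x ∷ xs)) ≡ indicator (q x) + + length (filterᵇ q xs)
  length-filterᵇ-∷ q x xs with q x
  ... | true  = refl
  ... | false = sym (ℤP.+-identityˡ _)

  length-by-key : ∀ (key : A → ℕ) N xs → All (λ x → key x < N) xs →
                  + length xs ≡ ∑ N (λ m → + length (filterᵇ (λ x → key x ≡ᵇ m) xs))
  length-by-key key N []       _                = sym (∑-zero N (λ _ _ → refl))
  length-by-key key N (x ∷ xs) (keyx<N ∷ keys<N) = begin
    + 1 + + length xs
      ≡⟨ cong₂ _+_ (sym (∑-indicator-≡ᵇ N (key x) keyx<N)) (length-by-key key N xs keys<N) ⟩
    ∑ N (λ m → indicator (key x ≡ᵇ m)) + ∑ N (λ m → + length (filterᵇ (keyIs m) xs))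
      ≡⟨ ∑-+ N (λ m → indicator (key x ≡ᵇ m)) (λ m → + length (filterᵇ (keyIs m) xs)) ⟨
    ∑ N (λ m → indicator (key x ≡ᵇ m) + + length (filterᵇ (keyIs m) xs))
      ≡⟨ ∑-cong N (λ m _ → length-filterᵇ-∷ (keyIs m) x xs) ⟨
    ∑ N (λ m → + length (filterᵇ (keyIs m) (x ∷ xs))) ∎
    where
    open ≡-Reasoning
    keyIs : ℕ → A → Bool
    keyIs m y = key y ≡ᵇ m

module ≗-Reasoning = SetoidReasoning (ℕ →-setoid ℤ)

⊛-coeff : ∀ (f g : Series) n → (f ⊛ g) n ≡ ∑ (suc n) (λ i → f i * g (n ∸ i))
⊛-coeff f g n = sumℤ-map-applyUpTo (λ i → f i * g (n ∸ i)) (λ i → i) (suc n)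

⊛-cong : ∀ {f f′ g g′ : Series} → f ≗ f′ → g ≗ g′ → f ⊛ g ≗ f′ ⊛ g′
⊛-cong f≗f′ g≗g′ n = cong sumℤ (LP.map-cong (λ i → cong₂ _*_ (f≗f′ i) (g≗g′ (n ∸ i))) (upTo (suc n)))

⊛-congʳ : ∀ f {g g′ : Series} → g ≗ g′ → f ⊛ g ≗ f ⊛ g′
⊛-congʳ f = ⊛-cong {f} {f} (λ _ → refl)

⊖-cong : ∀ {f f′ g g′ : Series} → f ≗ f′ → g ≗ g′ → f ⊖ g ≗ f′ ⊖ g′
⊖-cong f≗f′ g≗g′ n = cong₂ _-_ (f≗f′ n) (g≗g′ n)

⊛-comm : ∀ f g → f ⊛ g ≗ g ⊛ f
⊛-comm f g n = begin
  (f ⊛ g) n                                         ≡⟨ ⊛-coeff f g n ⟩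
  ∑ (suc n) (λ i → f i * g (n ∸ i))                 ≡⟨ ∑-reverse (suc n) (λ i → f i * g (n ∸ i)) ⟩
  ∑ (suc n) (λ i → f (n ∸ i) * g (n ∸ (n ∸ i)))     ≡⟨ ∑-cong (suc n) swap ⟩
  ∑ (suc n) (λ i → g i * f (n ∸ i))                 ≡⟨ sym (⊛-coeff g f n) ⟩
  (g ⊛ f) n                                         ∎
  where
  open ≡-Reasoning
  swap : ∀ i → i < suc n → f (n ∸ i) * g (n ∸ (n ∸ i)) ≡ g i * f (n ∸ i)
  swap i (s≤s i≤n) rewrite ℕP.m∸[m∸n]≡n i≤n = ℤP.*-comm (f (n ∸ i)) (g i)

⊛-assoc : ∀ f g h → (f ⊛ g) ⊛ h ≗ f ⊛ (g ⊛ h)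
⊛-assoc f g h n = begin
  ((f ⊛ g) ⊛ h) n                                       ≡⟨ ⊛-coeff (f ⊛ g) h n ⟩
  ∑ (suc n) (λ i → (f ⊛ g) i * h (n ∸ i))               ≡⟨ ∑-cong (suc n) inner ⟩
  ∑ (suc n) (λ i → ∑ (suc i) (λ j → F j (i ∸ j)))       ≡⟨ ∑-triangle n F ⟩
  ∑ (suc n) (λ j → ∑ (suc (n ∸ j)) (F j))               ≡⟨ ∑-cong (suc n) (λ j _ → outer j) ⟩
  ∑ (suc n) (λ j → f j * (g ⊛ h) (n ∸ j))               ≡⟨ sym (⊛-coeff f (g ⊛ h) n) ⟩
  (f ⊛ (g ⊛ h)) n                                       ∎
  where
  open ≡-Reasoning
  F : ℕ → ℕ → ℤ
  F j k = f j * (g k * h (n ∸ (j ℕ.+ k)))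
  inner : ∀ i → i < suc n → (f ⊛ g) i * h (n ∸ i) ≡ ∑ (suc i) (λ j → F j (i ∸ j))
  inner i _ = begin
    (f ⊛ g) i * h (n ∸ i)                          ≡⟨ cong (_* h (n ∸ i)) (⊛-coeff f g i) ⟩
    ∑ (suc i) (λ j → f j * g (i ∸ j)) * h (n ∸ i)  ≡⟨ sym (∑-*ʳ (suc i) (h (n ∸ i)) (λ j → f j * g (i ∸ j))) ⟩
    ∑ (suc i) (λ j → f j * g (i ∸ j) * h (n ∸ i))  ≡⟨ ∑-cong (suc i) regroup ⟩
    ∑ (suc i) (λ j → F j (i ∸ j))                  ∎
    where
    regroup : ∀ j → j < suc i → f j * g (i ∸ j) * h (n ∸ i) ≡ F j (i ∸ j)
    regroup j (s≤s j≤i) rewrite ℕP.m+[n∸m]≡n j≤i = ℤP.*-assoc (f j) (g (i ∸ j)) (h (n ∸ i))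
  outer : ∀ j → ∑ (suc (n ∸ j)) (F j) ≡ f j * (g ⊛ h) (n ∸ j)
  outer j = begin
    ∑ (suc (n ∸ j)) (F j)                                 ≡⟨ ∑-*ˡ (suc (n ∸ j)) (f j) (λ k → g k * h (n ∸ (j ℕ.+ k))) ⟩
    f j * ∑ (suc (n ∸ j)) (λ k → g k * h (n ∸ (j ℕ.+ k)))  ≡⟨ cong (f j *_) (∑-cong (suc (n ∸ j))
                                                               (λ k _ → cong (λ m → g k * h m) (sym (ℕP.∸-+-assoc n j k)))) ⟩
    f j * ∑ (suc (n ∸ j)) (λ k → g k * h (n ∸ j ∸ k))      ≡⟨ cong (f j *_) (sym (⊛-coeff g h (n ∸ j))) ⟩
    f j * (g ⊛ h) (n ∸ j)                                 ∎

⊛-distribʳ-⊕ : ∀ f g h → (f ⊕ g) ⊛ h ≗ f ⊛ h ⊕ g ⊛ h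
⊛-distribʳ-⊕ f g h n = begin
  ((f ⊕ g) ⊛ h) n                                                 ≡⟨ ⊛-coeff (f ⊕ g) h n ⟩
  ∑ (suc n) (λ i → (f i + g i) * h (n ∸ i))
    ≡⟨ ∑-cong (suc n) (λ i _ → ℤP.*-distribʳ-+ (h (n ∸ i)) (f i) (g i)) ⟩
  ∑ (suc n) (λ i → f i * h (n ∸ i) + g i * h (n ∸ i))
    ≡⟨ ∑-+ (suc n) (λ i → f i * h (n ∸ i)) (λ i → g i * h (n ∸ i)) ⟩
  ∑ (suc n) (λ i → f i * h (n ∸ i)) + ∑ (suc n) (λ i → g i * h (n ∸ i))
    ≡⟨ sym (cong₂ _+_ (⊛-coeff f h n) (⊛-coeff g h n)) ⟩
  (f ⊛ h ⊕ g ⊛ h) n                                               ∎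
  where open ≡-Reasoning

⊛-negˡ : ∀ f g → (λ n → - f n) ⊛ g ≗ (λ n → - (f ⊛ g) n)
⊛-negˡ f g n = begin
  ((λ n → - f n) ⊛ g) n                 ≡⟨ ⊛-coeff (λ n → - f n) g n ⟩
  ∑ (suc n) (λ i → - f i * g (n ∸ i))   ≡⟨ ∑-cong (suc n) (λ i _ → sym (ℤP.neg-distribˡ-* (f i) (g (n ∸ i)))) ⟩
  ∑ (suc n) (λ i → - (f i * g (n ∸ i))) ≡⟨ ∑-neg (suc n) (λ i → f i * g (n ∸ i)) ⟩
  - ∑ (suc n) (λ i → f i * g (n ∸ i))   ≡⟨ cong -_ (sym (⊛-coeff f g n)) ⟩
  - (f ⊛ g) n                           ∎
  where open ≡-Reasoning

⊛-distribʳ-⊖ : ∀ f g h → (f ⊖ g) ⊛ h ≗ f ⊛ h ⊖ g ⊛ h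
⊛-distribʳ-⊖ f g h n = trans (⊛-distribʳ-⊕ f (λ n → - g n) h n) (cong (_+_ ((f ⊛ h) n)) (⊛-negˡ g h n))

⊛-distribˡ-⊖ : ∀ f g h → f ⊛ (g ⊖ h) ≗ f ⊛ g ⊖ f ⊛ h
⊛-distribˡ-⊖ f g h n =
  trans (⊛-comm f (g ⊖ h) n) (trans (⊛-distribʳ-⊖ g h f n) (cong₂ _-_ (⊛-comm g f n) (⊛-comm h f n)))

⊛-identityˡ : ∀ f → one ⊛ f ≗ f
⊛-identityˡ f n = begin
  (one ⊛ f) n                                    ≡⟨ ⊛-coeff one f n ⟩
  + 1 * f n + ∑ n (λ i → + 0 * f (n ∸ suc i))    ≡⟨ cong₂ _+_ (ℤP.*-identityˡ (f n)) (∑-zero n (λ i _ → refl)) ⟩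
  f n + + 0                                      ≡⟨ ℤP.+-identityʳ (f n) ⟩
  f n                                            ∎
  where open ≡-Reasoning

t²-⊛-suc-suc : ∀ f n → (t² ⊛ f) (suc (suc n)) ≡ f n
t²-⊛-suc-suc f n = begin
  (t² ⊛ f) (suc (suc n))                                               ≡⟨ ⊛-coeff t² f (suc (suc n)) ⟩
  + 0 * f (suc (suc n)) + (+ 0 * f (suc n) + (+ 1 * f n + ∑ n _))
    ≡⟨ cong (λ x → + 0 + (+ 0 + (+ 1 * f n + x))) (∑-zero n (λ _ _ → refl)) ⟩
  + 0 + (+ 0 + (+ 1 * f n + + 0))
    ≡⟨ solve 1 (λ a → con (+ 0) :+ (con (+ 0) :+ (con (+ 1) :* a :+ con (+ 0))) := a) refl (f n) ⟩
  f n                                                                  ∎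
  where open ≡-Reasoning

inv1+t-⊛-unique : ∀ a d → a 0 ≡ d 0 → (∀ n → a (suc n) ≡ d n + d (suc n)) → inv1+t ⊛ a ≗ d
inv1+t-⊛-unique a d a₀ aₛ zero = trans (ℤP.+-identityʳ _) (trans (ℤP.*-identityˡ (a 0)) a₀)
inv1+t-⊛-unique a d a₀ aₛ (suc n) = begin
  (inv1+t ⊛ a) (suc n)                                    ≡⟨ ⊛-coeff inv1+t a (suc n) ⟩
  + 1 * a (suc n) + ∑ (suc n) (λ i → - inv1+t i * a (n ∸ i))
    ≡⟨ cong₂ _+_ (ℤP.*-identityˡ (a (suc n))) (trans (sym (⊛-coeff (λ i → - inv1+t i) a n)) (⊛-negˡ inv1+t a n)) ⟩
  a (suc n) - (inv1+t ⊛ a) n                               ≡⟨ cong₂ _-_ (aₛ n) (inv1+t-⊛-unique a d a₀ aₛ n) ⟩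
  d n + d (suc n) - d n                                   ≡⟨ solve 2 (λ x y → x :+ y :- x := y) refl (d n) (d (suc n)) ⟩
  d (suc n)                                               ∎
  where open ≡-Reasoning

over1+t : Series → Series
over1+t F = inv1+t ⊛ F

occSeries : Series → Series
occSeries F = t² ⊛ ((over1+t F ⊖ one) ⊛ over1+t F)

occSeries-closed-form : ∀ F → (t² ⊛ (F ⊛ (inv1+t ⊛ inv1+t)) ⊖ t² ⊛ inv1+t) ⊛ F ≗ occSeries F
occSeries-closed-form F = begin
  (t² ⊛ (F ⊛ (I ⊛ I)) ⊖ t² ⊛ I) ⊛ F      ≈⟨ ⊛-distribʳ-⊖ (t² ⊛ (F ⊛ (I ⊛ I))) (t² ⊛ I) F ⟩
  (t² ⊛ (F ⊛ (I ⊛ I))) ⊛ F ⊖ (t² ⊛ I) ⊛ F ≈⟨ ⊖-cong square (⊛-assoc t² I F) ⟩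
  t² ⊛ (D ⊛ D) ⊖ t² ⊛ D                  ≈⟨ ⊛-distribˡ-⊖ t² (D ⊛ D) D ⟨
  t² ⊛ (D ⊛ D ⊖ D)                       ≈⟨ ⊛-congʳ t² (⊖-cong {D ⊛ D} (λ _ → refl) (⊛-identityˡ D)) ⟨
  t² ⊛ (D ⊛ D ⊖ one ⊛ D)                 ≈⟨ ⊛-congʳ t² (⊛-distribʳ-⊖ D one D) ⟨
  occSeries F                            ∎
  where
  open ≗-Reasoning
  I D : Series
  I = inv1+t
  D = over1+t F
  square : (t² ⊛ (F ⊛ (I ⊛ I))) ⊛ F ≗ t² ⊛ (D ⊛ D)
  square = begin
    (t² ⊛ (F ⊛ (I ⊛ I))) ⊛ F  ≈⟨ ⊛-assoc t² (F ⊛ (I ⊛ I)) F ⟩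
    t² ⊛ ((F ⊛ (I ⊛ I)) ⊛ F)  ≈⟨ ⊛-congʳ t² (⊛-assoc F (I ⊛ I) F) ⟩
    t² ⊛ (F ⊛ ((I ⊛ I) ⊛ F))  ≈⟨ ⊛-congʳ t² (⊛-congʳ F (⊛-assoc I I F)) ⟩
    t² ⊛ (F ⊛ (I ⊛ D))        ≈⟨ ⊛-congʳ t² (⊛-assoc F I D) ⟨
    t² ⊛ ((F ⊛ I) ⊛ D)        ≈⟨ ⊛-congʳ t² (⊛-cong {g = D} (⊛-comm F I) (λ _ → refl)) ⟩
    t² ⊛ (D ⊛ D)              ∎

Prhs-closed-form : ∀ F → (one ⊕ t² ⊛ inv1+t ⊖ t² ⊛ (F ⊛ (inv1+t ⊛ inv1+t))) ⊛ F ≗ F ⊖ occSeries F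
Prhs-closed-form F n = begin
  ((one ⊕ X ⊖ Y) ⊛ F) n           ≡⟨ ⊛-distribʳ-⊖ (one ⊕ X) Y F n ⟩
  ((one ⊕ X) ⊛ F) n - (Y ⊛ F) n   ≡⟨ cong (_- (Y ⊛ F) n) (⊛-distribʳ-⊕ one X F n) ⟩
  (one ⊛ F) n + (X ⊛ F) n - (Y ⊛ F) n ≡⟨ cong (λ x → x + (X ⊛ F) n - (Y ⊛ F) n) (⊛-identityˡ F n) ⟩
  F n + (X ⊛ F) n - (Y ⊛ F) n     ≡⟨ solve 3 (λ a b c → a :+ b :- c := a :- (c :- b)) refl (F n) ((X ⊛ F) n) ((Y ⊛ F) n) ⟩
  F n - ((Y ⊛ F) n - (X ⊛ F) n)   ≡⟨ cong (_-_ (F n)) (⊛-distribʳ-⊖ Y X F n) ⟨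
  F n - ((Y ⊖ X) ⊛ F) n           ≡⟨ cong (_-_ (F n)) (occSeries-closed-form F n) ⟩
  F n - occSeries F n             ∎
  where
  open ≡-Reasoning
  X Y : Series
  X = t² ⊛ inv1+t
  Y = t² ⊛ (F ⊛ (inv1+t ⊛ inv1+t))

⊛₂-lift : ∀ (F : Series₂) g n k → (F ⊛₂ lift g) n k ≡ ((λ i → F i k) ⊛ g) n
⊛₂-lift F g n k = cong sumℤ (LP.map-cong inner (upTo (suc n)))
  where
  inner : ∀ i → sumℤ (map (λ j → F i j * lift g (n ∸ i) (k ∸ j)) (upTo (suc k))) ≡ F i k * g (n ∸ i)
  inner i = begin
    sumℤ (map (λ j → F i j * lift g (n ∸ i) (k ∸ j)) (upTo (suc k)))  ≡⟨ sumℤ-map-applyUpTo h (λ j → j) (suc k) ⟩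
    ∑ (suc k) h                                                       ≡⟨ ∑-only-last k h off-diagonal ⟩
    F i k * lift g (n ∸ i) (k ∸ k)                                    ≡⟨ cong (λ m → F i k * lift g (n ∸ i) m) (ℕP.n∸n≡0 k) ⟩
    F i k * g (n ∸ i)                                                 ∎
    where
    open ≡-Reasoning
    h : ℕ → ℤ
    h j = F i j * lift g (n ∸ i) (k ∸ j)
    off-diagonal : ∀ j → j < k → h j ≡ + 0
    off-diagonal j j<k rewrite ℕP.+-∸-assoc 1 j<k = ℤP.*-zeroʳ (F i j)

lift-⊛₂-1-u : ∀ f n k → (lift f ⊛₂ 1-u) n k ≡ f n * 1-u 0 k
lift-⊛₂-1-u f n k = begin
  (lift f ⊛₂ 1-u) n k                                     ≡⟨ sumℤ-map-applyUpTo row (λ i → i) (suc n) ⟩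
  ∑ (suc n) row                                           ≡⟨ ∑-cong (suc n) (λ i _ → inner i) ⟩
  ∑ (suc n) (λ i → f i * 1-u (n ∸ i) k)                   ≡⟨ ∑-only-last n (λ i → f i * 1-u (n ∸ i) k) off-diagonal ⟩
  f n * 1-u (n ∸ n) k                                     ≡⟨ cong (λ m → f n * 1-u m k) (ℕP.n∸n≡0 n) ⟩
  f n * 1-u 0 k                                           ∎
  where
  open ≡-Reasoning
  row : ℕ → ℤ
  row i = sumℤ (map (λ j → lift f i j * 1-u (n ∸ i) (k ∸ j)) (upTo (suc k)))
  inner : ∀ i → row i ≡ f i * 1-u (n ∸ i) k
  inner i = trans (sumℤ-map-applyUpTo (λ j → lift f i j * 1-u (n ∸ i) (k ∸ j)) (λ j → j) (suc k))
                  (∑-only-first k (λ j → lift f i j * 1-u (n ∸ i) (k ∸ j)) (λ _ _ → refl))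
  off-diagonal : ∀ i → i < n → f i * 1-u (n ∸ i) k ≡ + 0
  off-diagonal i i<n rewrite ℕP.+-∸-assoc 1 i<n = ℤP.*-zeroʳ (f i)

-- Erhs = G · A with G = 1 + (X − Y)(1 − u), so the u-coefficients of G are one ⊕ X ⊖ Y, Y ⊖ X and 0.
module _ where
  private
    X Y : Series
    G : Series₂
    X = t² ⊛ inv1+t
    Y = t² ⊛ (A ⊛ (inv1+t ⊛ inv1+t))
    G = lift one ⊕₂ (lift X ⊛₂ 1-u) ⊖₂ (lift Y ⊛₂ 1-u)

    Erhs-u^ : ∀ k {H : Series} → (λ i → G i k) ≗ H → ∀ n → Erhs n k ≡ (H ⊛ A) n
    Erhs-u^ k G≗H n = trans (⊛₂-lift G A n k) (⊛-cong {g = A} G≗H (λ _ → refl) n)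

  Erhs-u⁰ : ∀ n → Erhs n 0 ≡ Prhs n
  Erhs-u⁰ = Erhs-u^ 0 λ i → cong₂ (λ x y → one i + x - y) (u⁰ X i) (u⁰ Y i)
    where
    u⁰ : ∀ f i → (lift f ⊛₂ 1-u) i 0 ≡ f i
    u⁰ f i = trans (lift-⊛₂-1-u f i 0) (ℤP.*-identityʳ (f i))

  Erhs-u¹ : ∀ n → Erhs n 1 ≡ occSeries A n
  Erhs-u¹ n = trans (Erhs-u^ 1 coeff n) (occSeries-closed-form A n)
    where
    coeff : (λ i → G i 1) ≗ Y ⊖ X
    coeff i rewrite lift-⊛₂-1-u X i 1 | lift-⊛₂-1-u Y i 1 =
      solve 2 (λ x y → con (+ 0) :+ x :* con (- + 1) :- y :* con (- + 1) := y :- x) refl (X i) (Y i)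

  Erhs-u²⁺ : ∀ n k → Erhs n (suc (suc k)) ≡ + 0
  Erhs-u²⁺ n k = trans (Erhs-u^ (suc (suc k)) coeff n)
                 (trans (⊛-coeff (λ _ → + 0) A n) (∑-zero (suc n) (λ _ _ → refl)))
    where
    coeff : (λ i → G i (suc (suc k))) ≗ (λ _ → + 0)
    coeff i rewrite lift-⊛₂-1-u X i (suc (suc k)) | lift-⊛₂-1-u Y i (suc (suc k))
                  | ℤP.*-zeroʳ (X i) | ℤP.*-zeroʳ (Y i) = refl

-- Generating functions of king permutations

over1+t-A : ∀ (first : ℕ → ℕ) →
            (∀ m → length (K-notStartingWith (first m) m) ≡ length (K-startingWith (first (suc m)) (suc m))) →
            over1+t A ≗ (λ m → + length (K-notStartingWith (first m) m))
over1+t-A first prepend = inv1+t-⊛-unique A D refl step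
  where
  D : Series
  D m = + length (K-notStartingWith (first m) m)
  step : ∀ m → A (suc m) ≡ D m + D (suc m)
  step m = begin
    + length (K (suc m))
      ≡⟨ cong +_ (length-K-split (first (suc m)) (suc m)) ⟨
    + (length (K-startingWith (first (suc m)) (suc m)) ℕ.+ length (K-notStartingWith (first (suc m)) (suc m)))
      ≡⟨ cong (λ x → + (x ℕ.+ length (K-notStartingWith (first (suc m)) (suc m)))) (prepend m) ⟨
    + (length (K-notStartingWith (first m) m) ℕ.+ length (K-notStartingWith (first (suc m)) (suc m)))
      ≡⟨ ℤP.pos-+ (length (K-notStartingWith (first m) m)) (length (K-notStartingWith (first (suc m)) (suc m))) ⟩
    D m + D (suc m) ∎
    where open ≡-Reasoning

over1+t-A-max : over1+t A ≗ (λ m → + length (K-notStartingWith m m))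
over1+t-A-max = over1+t-A id length-K-startingWith-max

over1+t-A-min : over1+t A ≗ (λ m → + length (K-notStartingWith 1 m))
over1+t-A-min = over1+t-A (const 1) length-K-startingWith-min

occurringFrom-count : ∀ N m → m < N →
  + length (K-occurringFrom m (suc (suc N))) ≡ over1+t A (suc m) * over1+t A (N ∸ suc m)
occurringFrom-count N m m<N = begin
  + length (K-occurringFrom m (suc (suc N)))
    ≡⟨ cong (λ n → + length (K-occurringFrom m n)) size ⟩
  + length (K-occurringFrom m (suc (suc m) ℕ.+ suc j))
    ≡⟨ cong +_ (length-K-occurringFrom m (suc j)) ⟩
  + (length (K-startingWith (suc (suc m)) (suc (suc m))) ℕ.* length (K-startingWith 1 (suc j)))
    ≡⟨ cong₂ (λ x y → + (x ℕ.* y)) (length-K-startingWith-max (suc m)) (length-K-startingWith-min j) ⟨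
  + (length (K-notStartingWith (suc m) (suc m)) ℕ.* length (K-notStartingWith 1 j))
    ≡⟨ ℤP.pos-* (length (K-notStartingWith (suc m) (suc m))) (length (K-notStartingWith 1 j)) ⟩
  + length (K-notStartingWith (suc m) (suc m)) * + length (K-notStartingWith 1 j)
    ≡⟨ cong₂ _*_ (over1+t-A-max (suc m)) (over1+t-A-min j) ⟨
  over1+t A (suc m) * over1+t A j ∎
  where
  open ≡-Reasoning
  j : ℕ
  j = N ∸ suc m
  size : suc (suc N) ≡ suc (suc m) ℕ.+ suc j
  size = cong (suc ∘ suc) (trans (sym (ℕP.m+[n∸m]≡n m<N)) (sym (ℕP.+-suc m j)))

occSeries-A-coeff : ∀ N → occSeries A (suc (suc N)) ≡ ∑ N (λ m → over1+t A (suc m) * over1+t A (N ∸ suc m))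
occSeries-A-coeff N = begin
  occSeries A (suc (suc N))                            ≡⟨ t²-⊛-suc-suc ((D ⊖ one) ⊛ D) N ⟩
  ((D ⊖ one) ⊛ D) N                                    ≡⟨ ⊛-coeff (D ⊖ one) D N ⟩
  (D 0 - + 1) * D N + ∑ N (λ m → (D (suc m) - + 0) * D (N ∸ suc m))
    ≡⟨ cong₂ _+_ (cong (λ d → (d - + 1) * D N) (over1+t-A-max 0))
                 (∑-cong N (λ m _ → cong (_* D (N ∸ suc m)) (ℤP.+-identityʳ (D (suc m))))) ⟩
  + 0 + ∑ N (λ m → D (suc m) * D (N ∸ suc m))          ≡⟨ ℤP.+-identityˡ _ ⟩
  ∑ N (λ m → D (suc m) * D (N ∸ suc m))                ∎
  where
  open ≡-Reasoning
  D : Series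
  D = over1+t A

K-occurring-count : ∀ n → + length (K-occurring n) ≡ occSeries A n
K-occurring-count zero          = refl
K-occurring-count (suc zero)    = refl
K-occurring-count (suc (suc N)) = begin
  + length (K-occurring (suc (suc N)))
    ≡⟨ length-by-key (λ σ → firstEntry σ ∸ 2) N (K-occurring (suc (suc N))) (All.tabulate first-entry-bound) ⟩
  ∑ N (λ m → + length (K-occurringFrom m (suc (suc N))))
    ≡⟨ ∑-cong N (occurringFrom-count N) ⟩
  ∑ N (λ m → over1+t A (suc m) * over1+t A (N ∸ suc m))
    ≡⟨ occSeries-A-coeff N ⟨
  occSeries A (suc (suc N)) ∎
  where
  open ≡-Reasoning
  first-entry-bound : ∀ {σ} → σ ∈ K-occurring (suc (suc N)) → firstEntry σ ∸ 2 < N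
  first-entry-bound σ∈ with ∈-K-occurring⁻ {suc (suc N)} σ∈
  ... | perm , king , shape τ<a a<b b<ρ with shape-first-entry perm king τ<a a<b b<ρ
  ... | 2≤a , a<n = ℕP.∸-monoˡ-< a<n 2≤a

K-avoiding : ℕ → List (List ℕ)
K-avoiding n = filterᵇ (λ σ → p σ ≡ᵇ 0) (K n)

length-K-avoiding+occurring : ∀ n → length (K-avoiding n) ℕ.+ length (K-occurring n) ≡ length (K n)
length-K-avoiding+occurring n = begin
  length (K-avoiding n) ℕ.+ length (K-occurring n)
    ≡⟨ cong (λ xs → length (K-avoiding n) ℕ.+ length xs) (filterᵇ-cong-∈ (K n) not[p≡0]≡[p≡1]) ⟨
  length (K-avoiding n) ℕ.+ length (filterᵇ (not ∘ (λ σ → p σ ≡ᵇ 0)) (K n))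
    ≡⟨ length-filterᵇ-not (λ σ → p σ ≡ᵇ 0) (K n) ⟩
  length (K n) ∎
  where
  open ≡-Reasoning
  not[p≡0]≡[p≡1] : ∀ {σ} → σ ∈ K n → not (p σ ≡ᵇ 0) ≡ (p σ ≡ᵇ 1)
  not[p≡0]≡[p≡1] {σ} σ∈ with p σ | p≤1 (proj₁ (∈K⁻ n σ∈))
  ... | zero          | _ = refl
  ... | suc zero      | _ = refl
  ... | suc (suc _)   | s≤s ()

P≗A⊖occSeries : P ≗ A ⊖ occSeries A
P≗A⊖occSeries n = begin
  + length (K-avoiding n)
    ≡⟨ solve 2 (λ x y → x := x :+ y :- y) refl (+ length (K-avoiding n)) (+ length (K-occurring n)) ⟩
  + length (K-avoiding n) + + length (K-occurring n) - + length (K-occurring n)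
    ≡⟨ cong (_- + length (K-occurring n)) (ℤP.pos-+ (length (K-avoiding n)) (length (K-occurring n))) ⟨
  + (length (K-avoiding n) ℕ.+ length (K-occurring n)) - + length (K-occurring n)
    ≡⟨ cong₂ _-_ (cong +_ (length-K-avoiding+occurring n)) (K-occurring-count n) ⟩
  A n - occSeries A n                                       ∎
  where open ≡-Reasoning

E-u²⁺ : ∀ n k → E n (suc (suc k)) ≡ + 0
E-u²⁺ n k = cong +_ (cong length (LP.filter-none (T? ∘ (λ σ → p σ ≡ᵇ suc (suc k))) (All.tabulate p≢2+k)))
  where
  p≢2+k : ∀ {σ} → σ ∈ K n → ¬ T (p σ ≡ᵇ suc (suc k))
  p≢2+k {σ} σ∈ p≡2+k =
    ℕP.<⇒≱ (s≤s (s≤s z≤n)) (subst (_≤ 1) (ℕP.≡ᵇ⇒≡ (p σ) _ p≡2+k) (p≤1 (proj₁ (∈K⁻ n σ∈))))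

-- The initial terms

AgreeUpTo : ℕ → Series → Series → Set
AgreeUpTo n f g = ∀ i → i ≤ n → f i ≡ g i

AgreeUpTo-mono : ∀ {m n f g} → m ≤ n → AgreeUpTo n f g → AgreeUpTo m f g
AgreeUpTo-mono m≤n f≈g i i≤m = f≈g i (ℕP.≤-trans i≤m m≤n)

⊛-agree : ∀ {n f f′ g g′} → AgreeUpTo n f f′ → AgreeUpTo n g g′ → AgreeUpTo n (f ⊛ g) (f′ ⊛ g′)
⊛-agree {n} {f} {f′} {g} {g′} f≈f′ g≈g′ i i≤n = begin
  (f ⊛ g) i                            ≡⟨ ⊛-coeff f g i ⟩
  ∑ (suc i) (λ j → f j * g (i ∸ j))    ≡⟨ ∑-cong (suc i) (λ j j<1+i → cong₂ _*_ (f≈f′ j (ℕP.≤-trans (ℕP.≤-pred j<1+i) i≤n))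
                                                                            (g≈g′ (i ∸ j) (ℕP.≤-trans (ℕP.m∸n≤m i j) i≤n))) ⟩
  ∑ (suc i) (λ j → f′ j * g′ (i ∸ j))  ≡⟨ ⊛-coeff f′ g′ i ⟨
  (f′ ⊛ g′) i                          ∎
  where open ≡-Reasoning

occSeries-agree : ∀ {n F G} → AgreeUpTo n F G → occSeries F n ≡ occSeries G n
occSeries-agree {n} {F} {G} F≈G =
  ⊛-agree {f = t²} (λ _ _ → refl) (⊛-agree {f = over1+t F ⊖ one} (λ i i≤n → cong (_- one i) (D≈ i i≤n)) D≈)
          n ℕP.≤-refl
  where
  D≈ : AgreeUpTo n (over1+t F) (over1+t G)
  D≈ = ⊛-agree {f = inv1+t} (λ _ _ → refl) F≈G

A≡arrangements : ∀ n → A n ≡ + length (filterᵇ isKing (arrangements n (oneTo n)))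
A≡arrangements n = cong (λ ws → + length (filterᵇ isKing ws))
                        (trans (cong (filterᵇ distinct) (words≡wordsOver n n)) (filterᵇ-distinct-wordsOver n (oneTo n)))

A-initial : Series
A-initial 0 = + 1
A-initial 1 = + 1
A-initial 4 = + 2
A-initial 5 = + 14
A-initial 6 = + 90
A-initial 7 = + 646
A-initial 8 = + 5242
A-initial _ = + 0

-- The as-patterns keep both sides syntactically equal; with a literal, Agda would normalise A 8 through words 8 8.
A≈A-initial : AgreeUpTo 8 A A-initial
A≈A-initial n@0 _ = A≡arrangements n
A≈A-initial n@1 _ = A≡arrangements n
A≈A-initial n@2 _ = A≡arrangements n
A≈A-initial n@3 _ = A≡arrangements n
A≈A-initial n@4 _ = A≡arrangements n
A≈A-initial n@5 _ = A≡arrangements n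
A≈A-initial n@6 _ = A≡arrangements n
A≈A-initial n@7 _ = A≡arrangements n
A≈A-initial n@8 _ = A≡arrangements n
A≈A-initial (suc (suc (suc (suc (suc (suc (suc (suc (suc _)))))))))
  (s≤s (s≤s (s≤s (s≤s (s≤s (s≤s (s≤s (s≤s ()))))))))

initE-from-A-initial : ∀ n → n ≤ 8 → (A-initial n - occSeries A-initial n ≡ initE n 0)
                                   × (occSeries A-initial n ≡ initE n 1)
                                   × (∀ k → initE n (suc (suc k)) ≡ + 0)
initE-from-A-initial 0 _ = refl , refl , λ _ → refl
initE-from-A-initial 1 _ = refl , refl , λ _ → refl
initE-from-A-initial 2 _ = refl , refl , λ _ → refl
initE-from-A-initial 3 _ = refl , refl , λ _ → refl
initE-from-A-initial 4 _ = refl , refl , λ _ → refl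
initE-from-A-initial 5 _ = refl , refl , λ _ → refl
initE-from-A-initial 6 _ = refl , refl , λ _ → refl
initE-from-A-initial 7 _ = refl , refl , λ _ → refl
initE-from-A-initial 8 _ = refl , refl , λ _ → refl
initE-from-A-initial (suc (suc (suc (suc (suc (suc (suc (suc (suc _)))))))))
  (s≤s (s≤s (s≤s (s≤s (s≤s (s≤s (s≤s (s≤s ()))))))))

P≡Prhs : ∀ n → P n ≡ Prhs n
P≡Prhs n = trans (P≗A⊖occSeries n) (sym (Prhs-closed-form A n))

E≡Erhs : ∀ n k → E n k ≡ Erhs n k
E≡Erhs n zero          = trans (P≡Prhs n) (sym (Erhs-u⁰ n))
E≡Erhs n (suc zero)    = trans (K-occurring-count n) (sym (Erhs-u¹ n))
E≡Erhs n (suc (suc k)) = trans (E-u²⁺ n k) (sym (Erhs-u²⁺ n k))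

E≡initE : ∀ n k → n ≤ 8 → E n k ≡ initE n k
E≡initE n k n≤8 with initE-from-A-initial n n≤8 | k
... | u⁰ , _ , _  | zero        = trans (P≗A⊖occSeries n)
                                       (trans (cong₂ _-_ (A≈A-initial n n≤8) (occSeries-agree (AgreeUpTo-mono n≤8 A≈A-initial))) u⁰)
... | _ , u¹ , _  | suc zero    = trans (K-occurring-count n) (trans (occSeries-agree (AgreeUpTo-mono n≤8 A≈A-initial)) u¹)
... | _ , _ , u²⁺ | suc (suc k) = trans (E-u²⁺ n k) (sym (u²⁺ k))

theorem3p6 : ((n : ℕ) → P n ≡ Prhs n)
           × ((n k : ℕ) → E n k ≡ Erhs n k)
           × ((n k : ℕ) → n ≤ 8 → E n k ≡ initE n k)
theorem3p6 = P≡Prhs , E≡Erhs , E≡initE
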